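{- Let $(k_n)_{n\ge 2}$ be any sequence of integers with $1\le k_n\le n-1$. Then \[\lim_{n\to\infty}\frac{Kf(Q_{n,k_n})}{\frac{2^{2n}}{n+1}}=1.\]
   Context: For $n\ge 2$ and $1\le k\le n-1$, the enhanced hypercube $Q_{n,k}$ is the simple graph whose vertices are the binary strings $x_1x_2\cdots x_n$ ($x_i\in\{0,1\}$), where $X=x_1\cdots x_n$ and $Y$ are adjacent iff either $Y$ is obtained from $X$ by complementing exactly one coordinate ($1\le i\le n$), or $Y=x_1\cdots x_{k-1}\overline{x_k}\,\overline{x_{k+1}}\cdots\overline{x_n}$. For a connected graph $\Gamma$, the resistance distance $r_{ij}$ between vertices $v_i,v_j$ is the effective resistance between them when every edge is a unit resistor, and the Kirchhoff index is $Kf(\Gamma)=\sum_{i<j} r_{ij}$. -}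

module Defs where

open import Data.Bool using (Bool; true; false; not; _∨_; if_then_else_)
open import Data.Bool.Properties using () renaming (_≟_ to _≟B_)
open import Data.Nat as ℕ using (ℕ; zero; suc; _∸_; _≡ᵇ_; _≤_)
open import Data.Nat.Properties using (m^n≢0)
open import Data.Integer using (+_)
open import Data.Rational using (ℚ; 0ℚ; 1ℚ; _+_; _-_; _*_; _/_; ∣_∣; _<_)
open import Data.Vec using (Vec; []; _∷_; map)
open import Data.Vec.Properties using (≡-dec)
open import Data.List using (List; []; _∷_; _++_; concatMap) renaming (map to lmap; foldr to lfoldr)
open import Data.Product using (_×_; _,_; ∃; ∃-syntax)
open import Relation.Nullary.Decidable using (⌊_⌋)
open import Relation.Binary.PropositionalEquality using (_≡_)

-- Vertices of Q_{n,k}: binary strings of length n (Bool = {0,1}).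
-- All 2^n binary strings of length n, as a list without repetitions.
allStrings : (n : ℕ) → List (Vec Bool n)
allStrings zero    = [] ∷ []
allStrings (suc n) = lmap (false ∷_) (allStrings n) ++ lmap (true ∷_) (allStrings n)

sumL : {A : Set} → List A → (A → ℚ) → ℚ
sumL xs f = lfoldr (λ a s → f a + s) 0ℚ xs

pairsLT : {A : Set} → List A → List (A × A)
pairsLT []       = []
pairsLT (x ∷ xs) = lmap (x ,_) xs ++ pairsLT xs

hamming : {n : ℕ} → Vec Bool n → Vec Bool n → ℕ
hamming []       []       = zero
hamming (x ∷ xs) (y ∷ ys) = (if ⌊ x ≟B y ⌋ then zero else 1) ℕ.+ hamming xs ys

keepFlip : {n : ℕ} → ℕ → Vec Bool n → Vec Bool n
keepFlip zero    xs       = map not xs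
keepFlip (suc m) []       = []
keepFlip (suc m) (x ∷ xs) = x ∷ keepFlip m xs

-- the special neighbour x_1 ... x_{k-1} ~x_k ~x_{k+1} ... ~x_n  (1-indexed k)
complTail : {n : ℕ} → ℕ → Vec Bool n → Vec Bool n
complTail k = keepFlip (k ∸ 1)

adj : (n k : ℕ) → Vec Bool n → Vec Bool n → Bool
adj n k X Y = (hamming X Y ≡ᵇ 1) ∨ ⌊ ≡-dec _≟B_ Y (complTail k X) ⌋

laplacian : (n k : ℕ) → (Vec Bool n → ℚ) → Vec Bool n → ℚ
laplacian n k x v =
  sumL (allStrings n) (λ u → if adj n k v u then x v - x u else 0ℚ)

δ : {n : ℕ} → Vec Bool n → Vec Bool n → ℚ
δ i v = if ⌊ ≡-dec _≟B_ i v ⌋ then 1ℚ else 0ℚ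

-- r is the resistance-distance function of Q_{n,k} (unit resistors):
-- injecting unit current at i and extracting it at j, the node potentials x
-- satisfy Kirchhoff's/Ohm's laws L x = e_i - e_j, and r_ij = x_i - x_j.
IsResistanceDistance : (n k : ℕ) → (Vec Bool n → Vec Bool n → ℚ) → Set
IsResistanceDistance n k r =
  ∀ i j → ∃[ x ] ((∀ v → laplacian n k x v ≡ δ i v - δ j v) × r i j ≡ x i - x j)

kirchhoff : (n : ℕ) → (Vec Bool n → Vec Bool n → ℚ) → ℚ
kirchhoff n r = sumL (pairsLT (allStrings n)) (λ p → r (Data.Product.proj₁ p) (Data.Product.proj₂ p))

normalizedKf : (n : ℕ) → (Vec Bool n → Vec Bool n → ℚ) → ℚ
normalizedKf n r = kirchhoff n r * ((+ suc n) / (2 ℕ.^ (2 ℕ.* n))) {{m^n≢0 2 (2 ℕ.* n)}}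

ConvergesTo : (ℕ → ℚ) → ℚ → Set
ConvergesTo a L = ∀ (ε : ℚ) → 0ℚ < ε → ∃[ N ] (∀ n → N ≤ n → ∣ a n - L ∣ < ε)

module Submission where

-- Q_{n,k} is the Cayley graph of (ℤ/2)ⁿ generated by the n unit vectors and
-- the mask t = 0^{k-1}1^{n-k+1}.  Its Laplacian is therefore diagonal in the
-- characters χ_S(v) = (-1)^⟨S,v⟩, with eigenvalue ev(S) = 2|S| + 2⟨S,t⟩.
-- Solving Kirchhoff's equations mode by mode gives
--   2ⁿ r_ij = Σ_S (χ_S(i) - χ_S(j))² / ev(S),   hence   Kf = 2ⁿ Σ_{S≠0} 1/ev(S),
-- so the normalised index is (n+1)/2ⁿ · W with W = Σ_S 1/ev(S) (1/0 := 0).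
-- Since 2|S| ≤ ev(S) ≤ 2|S| + 2, W is squeezed between binomial sums
-- Σ_s C(n,s)/(s+1) = (2ⁿ⁺¹-1)/(n+1) and Σ_s C(n,s)/((s+1)(s+2)) ≤ 2ⁿ⁺²/((n+1)(n+2)),
-- which yields |(n+1)/2ⁿ · W - 1| ≤ 6/(n+2) uniformly in k, and the limit.

open import Defs
open import Data.Bool using (Bool; true; false; not; _∧_; _∨_; _xor_; if_then_else_)
open import Data.Bool.Properties using (∧-distribˡ-xor; ∧-zeroʳ) renaming (_≟_ to _≟B_)
open import Data.Nat as ℕ using (ℕ; zero; suc; _≤_; _∸_; _≡ᵇ_)
import Data.Nat.Properties as ℕP
open import Data.Nat.Tactic.RingSolver using (solve-∀)
open import Data.Nat.Combinatorics using (_C_; nCk+nC[k+1]≡[n+1]C[k+1])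
import Data.Integer as ℤ
import Data.Integer.Properties as ℤP
open import Data.Rational as Q using (ℚ; 0ℚ; 1ℚ; _+_; _*_; _-_; -_; 1/_; _/_; ∣_∣)
  renaming (_≤_ to _≤q_; _<_ to _<q_)
import Data.Rational.Properties as QP
import Data.Rational.Unnormalised as U
import Data.Rational.Unnormalised.Properties as UP
open import Data.Rational.Solver using (module +-*-Solver)
open import Data.Vec using (Vec; []; _∷_; replicate; zipWith)
open import Data.Vec.Properties using (≡-dec)
open import Data.List using (List; []; _∷_; _++_) renaming (map to lmap)
open import Data.Product using (_×_; _,_; proj₁; proj₂; ∃-syntax)
open import Data.Sum using (_⊎_; inj₁; inj₂)
open import Data.Empty using (⊥; ⊥-elim)
open import Relation.Nullary.Decidable using (⌊_⌋; yes; no; toWitness)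
open import Relation.Binary.PropositionalEquality
open +-*-Solver

module _ {A : Set} where

  sum-++ : (xs ys : List A) (f : A → ℚ) → sumL (xs ++ ys) f ≡ sumL xs f + sumL ys f
  sum-++ []       ys f = sym (QP.+-identityˡ _)
  sum-++ (x ∷ xs) ys f rewrite sum-++ xs ys f = sym (QP.+-assoc (f x) _ _)

  sum-cong : (xs : List A) {f g : A → ℚ} → (∀ a → f a ≡ g a) → sumL xs f ≡ sumL xs g
  sum-cong []       f≡g = refl
  sum-cong (x ∷ xs) f≡g = cong₂ _+_ (f≡g x) (sum-cong xs f≡g)

  sum-0 : (xs : List A) → sumL xs (λ _ → 0ℚ) ≡ 0ℚ
  sum-0 []       = refl
  sum-0 (x ∷ xs) rewrite sum-0 xs = refl

  sum-+ : (xs : List A) (f g : A → ℚ) → sumL xs (λ a → f a + g a) ≡ sumL xs f + sumL xs g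
  sum-+ []       f g = refl
  sum-+ (x ∷ xs) f g rewrite sum-+ xs f g =
    solve 4 (λ a b c d → (a :+ b) :+ (c :+ d) := (a :+ c) :+ (b :+ d)) refl
      (f x) (g x) (sumL xs f) (sumL xs g)

  sum-*ˡ : (xs : List A) (c : ℚ) (f : A → ℚ) → sumL xs (λ a → c * f a) ≡ c * sumL xs f
  sum-*ˡ []       c f = sym (QP.*-zeroʳ c)
  sum-*ˡ (x ∷ xs) c f rewrite sum-*ˡ xs c f = sym (QP.*-distribˡ-+ c (f x) _)

  sum-*ʳ : (xs : List A) (c : ℚ) (f : A → ℚ) → sumL xs (λ a → f a * c) ≡ sumL xs f * c
  sum-*ʳ xs c f =
    trans (sum-cong xs (λ a → QP.*-comm (f a) c)) (trans (sum-*ˡ xs c f) (QP.*-comm c _))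

  sum-neg : (xs : List A) (f : A → ℚ) → sumL xs (λ a → - f a) ≡ - sumL xs f
  sum-neg []       f = refl
  sum-neg (x ∷ xs) f rewrite sum-neg xs f = sym (QP.neg-distrib-+ (f x) _)

  sum-- : (xs : List A) (f g : A → ℚ) → sumL xs (λ a → f a - g a) ≡ sumL xs f - sumL xs g
  sum-- xs f g = trans (sum-+ xs f (λ a → - g a)) (cong (sumL xs f +_) (sum-neg xs g))

  sum-mono : (xs : List A) {f g : A → ℚ} → (∀ a → f a ≤q g a) → sumL xs f ≤q sumL xs g
  sum-mono []       f≤g = QP.≤-refl
  sum-mono (x ∷ xs) f≤g = QP.+-mono-≤ (f≤g x) (sum-mono xs f≤g)

sum-map : {A B : Set} (g : A → B) (xs : List A) (f : B → ℚ) →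
          sumL (lmap g xs) f ≡ sumL xs (λ a → f (g a))
sum-map g []       f = refl
sum-map g (x ∷ xs) f rewrite sum-map g xs f = refl

sum-swap : {A B : Set} (xs : List A) (ys : List B) (f : A → B → ℚ) →
           sumL xs (λ a → sumL ys (f a)) ≡ sumL ys (λ b → sumL xs (λ a → f a b))
sum-swap []       ys f = sym (sum-0 ys)
sum-swap (x ∷ xs) ys f rewrite sum-swap xs ys f = sym (sum-+ ys (f x) (λ b → sumL xs (λ a → f a b)))

sum-pairsLT : {A : Set} (xs : List A) (f : A → A → ℚ) →
              (∀ a → f a a ≡ 0ℚ) → (∀ a b → f a b ≡ f b a) →
              sumL xs (λ a → sumL xs (f a))
                ≡ sumL (pairsLT xs) (λ p → f (proj₁ p) (proj₂ p)) + sumL (pairsLT xs) (λ p → f (proj₁ p) (proj₂ p))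
sum-pairsLT []       f diag symm = refl
sum-pairsLT (x ∷ xs) f diag symm = begin
  (f x x + B) + sumL xs (λ a → f a x + sumL xs (f a))
    ≡⟨ cong₂ _+_ (cong (_+ B) (diag x)) (sum-+ xs (λ a → f a x) (λ a → sumL xs (f a))) ⟩
  (0ℚ + B) + (sumL xs (λ a → f a x) + sumL xs (λ a → sumL xs (f a)))
    ≡⟨ cong₂ (λ u v → (0ℚ + B) + (u + v)) (sum-cong xs (λ a → symm a x)) (sum-pairsLT xs f diag symm) ⟩
  (0ℚ + B) + (B + (P + P))
    ≡⟨ solve 2 (λ b p → (con 0ℚ :+ b) :+ (b :+ (p :+ p)) := (b :+ p) :+ (b :+ p)) refl B P ⟩
  (B + P) + (B + P)
    ≡⟨ cong (λ z → z + z) (sym (trans (sum-++ (lmap (x ,_) xs) (pairsLT xs) g) (cong (_+ P) (sum-map (x ,_) xs g)))) ⟩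
  sumL (pairsLT (x ∷ xs)) g + sumL (pairsLT (x ∷ xs)) g ∎
  where
  open ≡-Reasoning
  g = λ (p : _ × _) → f (proj₁ p) (proj₂ p)
  B = sumL xs (f x)
  P = sumL (pairsLT xs) g

-- Natural numbers inside ℚ.  `ι` is the embedding (by recursion, so that it
-- is additive by construction) and `inv n` is 1/n, with the convention
-- inv 0 = 0; this convention is exactly the pseudo-inverse of a zero eigenvalue.

ι : ℕ → ℚ
ι zero    = 0ℚ
ι (suc n) = 1ℚ + ι n

ι-+ : ∀ m n → ι (m ℕ.+ n) ≡ ι m + ι n
ι-+ zero    n = sym (QP.+-identityˡ _)
ι-+ (suc m) n rewrite ι-+ m n = sym (QP.+-assoc 1ℚ (ι m) (ι n))

ι-* : ∀ m n → ι (m ℕ.* n) ≡ ι m * ι n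
ι-* zero    n = sym (QP.*-zeroˡ (ι n))
ι-* (suc m) n rewrite ι-+ n (m ℕ.* n) | ι-* m n =
  solve 2 (λ a b → b :+ a :* b := (con 1ℚ :+ a) :* b) refl (ι m) (ι n)

0<1 : 0ℚ <q 1ℚ
0<1 = Q.*<* (ℤ.+<+ (ℕ.s≤s ℕ.z≤n))

0≤ι : ∀ n → 0ℚ ≤q ι n
0≤ι zero    = QP.≤-refl
0≤ι (suc n) = QP.+-mono-≤ (QP.<⇒≤ 0<1) (0≤ι n)

0<ι : ∀ n → 0ℚ <q ι (suc n)
0<ι n = QP.+-mono-<-≤ 0<1 (0≤ι n)

ι-mono : ∀ {m n} → m ℕ.≤ n → ι m ≤q ι n
ι-mono {zero}  {n}     _           = 0≤ι n
ι-mono {suc m} {suc n} (ℕ.s≤s m≤n) = QP.+-monoʳ-≤ 1ℚ (ι-mono m≤n)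

inv : ℕ → ℚ
inv zero    = 0ℚ
inv (suc n) = (1/ ι (suc n)) {{Q.>-nonZero (0<ι n)}}

ι*inv : ∀ n .{{_ : ℕ.NonZero n}} → ι n * inv n ≡ 1ℚ
ι*inv (suc n) = QP.*-inverseʳ (ι (suc n)) {{Q.>-nonZero (0<ι n)}}

inv*ι : ∀ n .{{_ : ℕ.NonZero n}} → inv n * ι n ≡ 1ℚ
inv*ι n = trans (QP.*-comm (inv n) (ι n)) (ι*inv n)

0<inv : ∀ n → 0ℚ <q inv (suc n)
0<inv n = QP.positive⁻¹ _ {{QP.1/pos⇒pos (ι (suc n)) {{Q.positive (0<ι n)}}}}

0≤inv : ∀ n → 0ℚ ≤q inv n
0≤inv zero    = QP.≤-refl
0≤inv (suc n) = QP.<⇒≤ (0<inv n)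

ι-cancelʳ : ∀ a b m .{{_ : ℕ.NonZero m}} → a * ι m ≡ b * ι m → a ≡ b
ι-cancelʳ a b m e = begin
  a                    ≡⟨ sym (QP.*-identityʳ a) ⟩
  a * 1ℚ               ≡⟨ cong (a *_) (sym (ι*inv m)) ⟩
  a * (ι m * inv m)    ≡⟨ sym (QP.*-assoc a (ι m) (inv m)) ⟩
  a * ι m * inv m      ≡⟨ cong (_* inv m) e ⟩
  b * ι m * inv m      ≡⟨ QP.*-assoc b (ι m) (inv m) ⟩
  b * (ι m * inv m)    ≡⟨ cong (b *_) (ι*inv m) ⟩
  b * 1ℚ               ≡⟨ QP.*-identityʳ b ⟩
  b                    ∎
  where open ≡-Reasoning

inv-* : ∀ a b → inv (a ℕ.* b) ≡ inv a * inv b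
inv-* zero    b       = sym (QP.*-zeroˡ (inv b))
inv-* (suc a) zero    rewrite ℕP.*-zeroʳ a = sym (QP.*-zeroʳ (inv (suc a)))
inv-* (suc a) (suc b) = ι-cancelʳ _ _ (suc a ℕ.* suc b) (begin
  inv (A ℕ.* B) * ι (A ℕ.* B)          ≡⟨ inv*ι (A ℕ.* B) ⟩
  1ℚ                                   ≡⟨ cong₂ _*_ (sym (inv*ι A)) (sym (inv*ι B)) ⟩
  (inv A * ι A) * (inv B * ι B)
    ≡⟨ solve 4 (λ x y u v → (u :* x) :* (v :* y) := (u :* v) :* (x :* y)) refl (ι A) (ι B) (inv A) (inv B) ⟩
  (inv A * inv B) * (ι A * ι B)        ≡⟨ cong ((inv A * inv B) *_) (sym (ι-* A B)) ⟩
  (inv A * inv B) * ι (A ℕ.* B)        ∎)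
  where
  open ≡-Reasoning
  A = suc a
  B = suc b

inv-anti : ∀ a b → suc a ℕ.≤ b → inv b ≤q inv (suc a)
inv-anti a (suc b) a<b = begin
  inv (suc b)                              ≡⟨ sym (QP.*-identityʳ _) ⟩
  inv (suc b) * 1ℚ                         ≡⟨ cong (inv (suc b) *_) (sym (ι*inv (suc a))) ⟩
  inv (suc b) * (ι (suc a) * inv (suc a))
    ≤⟨ QP.*-monoˡ-≤-nonNeg (inv (suc b)) {{Q.nonNegative (0≤inv (suc b))}}
         (QP.*-monoʳ-≤-nonNeg (inv (suc a)) {{Q.nonNegative (0≤inv (suc a))}} (ι-mono a<b)) ⟩
  inv (suc b) * (ι (suc b) * inv (suc a))  ≡⟨ sym (QP.*-assoc (inv (suc b)) _ _) ⟩
  inv (suc b) * ι (suc b) * inv (suc a)    ≡⟨ cong (_* inv (suc a)) (inv*ι (suc b)) ⟩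
  1ℚ * inv (suc a)                         ≡⟨ QP.*-identityˡ _ ⟩
  inv (suc a)                              ∎
  where open QP.≤-Reasoning

ι≃mkℚᵘ : ∀ a → Q.toℚᵘ (ι a) U.≃ U.mkℚᵘ (ℤ.+ a) 0
ι≃mkℚᵘ zero    = UP.≃-refl
ι≃mkℚᵘ (suc a) = UP.≃-trans (QP.toℚᵘ-homo-+ 1ℚ (ι a))
  (UP.≃-trans (UP.+-cong (UP.≃-refl {U.mkℚᵘ (ℤ.+ 1) 0}) (ι≃mkℚᵘ a)) (U.*≡* cross))
  where
  cross : (ℤ.+ 1 ℤ.* ℤ.+ 1 ℤ.+ ℤ.+ a ℤ.* ℤ.+ 1) ℤ.* ℤ.+ 1 ≡ ℤ.+ suc a ℤ.* ℤ.+ 1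
  cross rewrite ℤP.*-identityʳ (ℤ.+ a) = refl

fraction : ∀ a d → .{{_ : ℕ.NonZero d}} → (ℤ.+ a) / d ≡ ι a * inv d
fraction a (suc b) = ι-cancelʳ _ _ (suc b) (trans times-d (sym (begin
  ι a * inv (suc b) * ι (suc b)    ≡⟨ QP.*-assoc (ι a) _ _ ⟩
  ι a * (inv (suc b) * ι (suc b))  ≡⟨ cong (ι a *_) (inv*ι (suc b)) ⟩
  ι a * 1ℚ                         ≡⟨ QP.*-identityʳ (ι a) ⟩
  ι a                              ∎)))
  where
  open ≡-Reasoning
  cross : (ℤ.+ a ℤ.* ℤ.+ suc b) ℤ.* ℤ.+ 1 ≡ ℤ.+ a ℤ.* ℤ.+ suc (b ℕ.* 1)
  cross rewrite ℕP.*-identityʳ b = ℤP.*-identityʳ _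
  times-d : ((ℤ.+ a) / suc b) * ι (suc b) ≡ ι a
  times-d = QP.toℚᵘ-injective (UP.≃-trans (QP.toℚᵘ-homo-* ((ℤ.+ a) / suc b) (ι (suc b)))
    (UP.≃-trans (UP.*-cong (QP.toℚᵘ-fromℚᵘ (U.mkℚᵘ (ℤ.+ a) b)) (ι≃mkℚᵘ (suc b)))
      (UP.≃-trans (U.*≡* cross) (UP.≃-sym (ι≃mkℚᵘ a)))))

cross-multiply : ∀ c d x y .{{_ : ℕ.NonZero c}} .{{_ : ℕ.NonZero d}} →
                 c ℕ.* x ≡ d ℕ.* y → ι y * inv c ≡ ι x * inv d
cross-multiply c d x y cx≡dy = ι-cancelʳ _ _ c (ι-cancelʳ _ _ d (begin
  ι y * inv c * ι c * ι d       ≡⟨ solve 4 (λ Y ic C D → Y :* ic :* C :* D := (D :* Y) :* (ic :* C)) refl (ι y) (inv c) (ι c) (ι d) ⟩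
  (ι d * ι y) * (inv c * ι c)   ≡⟨ cong₂ _*_ (trans (sym (ι-* d y)) (trans (cong ι (sym cx≡dy)) (ι-* c x))) (inv*ι c) ⟩
  (ι c * ι x) * 1ℚ              ≡⟨ solve 2 (λ C X → (C :* X) :* con 1ℚ := X :* con 1ℚ :* C) refl (ι c) (ι x) ⟩
  ι x * 1ℚ * ι c                ≡⟨ cong (λ z → ι x * z * ι c) (sym (inv*ι d)) ⟩
  ι x * (inv d * ι d) * ι c     ≡⟨ solve 4 (λ X id D C → X :* (id :* D) :* C := X :* id :* C :* D) refl (ι x) (inv d) (ι d) (ι c) ⟩
  ι x * inv d * ι c * ι d       ∎))
  where open ≡-Reasoning

private
  clear-denominator : ∀ x c d .{{_ : ℕ.NonZero c}} → ι x * inv c * (ι c * ι d) ≡ ι (x ℕ.* d)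
  clear-denominator x c d = begin
    ι x * inv c * (ι c * ι d)   ≡⟨ solve 4 (λ X I C D → X :* I :* (C :* D) := X :* (I :* C) :* D) refl (ι x) (inv c) (ι c) (ι d) ⟩
    ι x * (inv c * ι c) * ι d   ≡⟨ cong (λ z → ι x * z * ι d) (inv*ι c) ⟩
    ι x * 1ℚ * ι d              ≡⟨ cong (_* ι d) (QP.*-identityʳ (ι x)) ⟩
    ι x * ι d                   ≡⟨ sym (ι-* x d) ⟩
    ι (x ℕ.* d)                 ∎
    where open ≡-Reasoning

  clear-denominator′ : ∀ y c d .{{_ : ℕ.NonZero d}} → ι y * inv d * (ι c * ι d) ≡ ι (y ℕ.* c)
  clear-denominator′ y c d = trans (cong (ι y * inv d *_) (QP.*-comm (ι c) (ι d))) (clear-denominator y d c)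

  0<ι* : ∀ c d .{{_ : ℕ.NonZero c}} .{{_ : ℕ.NonZero d}} → Q.Positive (ι c * ι d)
  0<ι* (suc c) (suc d) = QP.pos*pos⇒pos (ι (suc c)) {{Q.positive (0<ι c)}} (ι (suc d)) {{Q.positive (0<ι d)}}

ratio-≤ : ∀ x y c d .{{_ : ℕ.NonZero c}} .{{_ : ℕ.NonZero d}} →
          x ℕ.* d ℕ.≤ y ℕ.* c → ι x * inv c ≤q ι y * inv d
ratio-≤ x y c d xd≤yc = QP.*-cancelʳ-≤-pos (ι c * ι d) {{0<ι* c d}} (begin
  ι x * inv c * (ι c * ι d)  ≡⟨ clear-denominator x c d ⟩
  ι (x ℕ.* d)                ≤⟨ ι-mono xd≤yc ⟩
  ι (y ℕ.* c)                ≡⟨ sym (clear-denominator′ y c d) ⟩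
  ι y * inv d * (ι c * ι d)  ∎)
  where open QP.≤-Reasoning

ratio-< : ∀ x y c d .{{_ : ℕ.NonZero c}} .{{_ : ℕ.NonZero d}} →
          x ℕ.* d ℕ.< y ℕ.* c → ι x * inv c <q ι y * inv d
ratio-< x y c d xd<yc = QP.*-cancelʳ-<-nonNeg (ι c * ι d) {{QP.pos⇒nonNeg (ι c * ι d) {{0<ι* c d}}}} (begin-strict
  ι x * inv c * (ι c * ι d)  ≡⟨ clear-denominator x c d ⟩
  ι (x ℕ.* d)                <⟨ ι-strict xd<yc ⟩
  ι (y ℕ.* c)                ≡⟨ sym (clear-denominator′ y c d) ⟩
  ι y * inv d * (ι c * ι d)  ∎)
  where
  open QP.≤-Reasoning
  ι-strict : ∀ {m n} → m ℕ.< n → ι m <q ι n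
  ι-strict {m} {suc n} (ℕ.s≤s m≤n) = QP.≤-<-trans (ι-mono m≤n)
    (QP.≤-<-trans (QP.≤-reflexive (sym (QP.+-identityˡ (ι n)))) (QP.+-mono-<-≤ 0<1 (QP.≤-refl {ι n})))

≤-+-nonneg : ∀ p q → 0ℚ ≤q q → p ≤q q + p
≤-+-nonneg p q 0≤q = begin
  p        ≡⟨ sym (QP.+-identityˡ p) ⟩
  0ℚ + p   ≤⟨ QP.+-monoˡ-≤ p 0≤q ⟩
  q + p    ∎
  where open QP.≤-Reasoning

V : ℕ → Set
V = Vec Bool

_⊕_ : ∀ {n} → V n → V n → V n
_⊕_ = zipWith _xor_

⊕-invol : ∀ {n} (v m : V n) → (v ⊕ m) ⊕ m ≡ v
⊕-invol []          []          = refl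
⊕-invol (false ∷ v) (false ∷ m) = cong (false ∷_) (⊕-invol v m)
⊕-invol (false ∷ v) (true ∷ m)  = cong (false ∷_) (⊕-invol v m)
⊕-invol (true ∷ v)  (false ∷ m) = cong (true ∷_) (⊕-invol v m)
⊕-invol (true ∷ v)  (true ∷ m)  = cong (true ∷_) (⊕-invol v m)

zeros : ∀ n → V n
zeros n = replicate n false

⊕-zeros : ∀ {n} (v : V n) → v ⊕ zeros n ≡ v
⊕-zeros []          = refl
⊕-zeros (false ∷ v) = cong (false ∷_) (⊕-zeros v)
⊕-zeros (true ∷ v)  = cong (true ∷_) (⊕-zeros v)

wt : ∀ {n} → V n → ℕ
wt []      = 0
wt (b ∷ v) = (if b then 1 else 0) ℕ.+ wt v

hamming-⊕ : ∀ {n} (v m : V n) → hamming v (v ⊕ m) ≡ wt m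
hamming-⊕ []          []          = refl
hamming-⊕ (false ∷ v) (false ∷ m) = hamming-⊕ v m
hamming-⊕ (false ∷ v) (true ∷ m)  = cong suc (hamming-⊕ v m)
hamming-⊕ (true ∷ v)  (false ∷ m) = hamming-⊕ v m
hamming-⊕ (true ∷ v)  (true ∷ m)  = cong suc (hamming-⊕ v m)

-- Structural boolean equality of strings, agreeing with the decision
-- procedure `≡-dec` used by Defs but computing coordinatewise.
_=ᵇ_ : Bool → Bool → Bool
a =ᵇ b = not (a xor b)

_=ᵛ_ : ∀ {n} → V n → V n → Bool
[]      =ᵛ []      = true
(a ∷ u) =ᵛ (b ∷ v) = (a =ᵇ b) ∧ (u =ᵛ v)

≡-dec-cons : ∀ {n} a b (u v : V n) →
             ⌊ ≡-dec _≟B_ (a ∷ u) (b ∷ v) ⌋ ≡ (a =ᵇ b) ∧ ⌊ ≡-dec _≟B_ u v ⌋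
≡-dec-cons false false u v with ≡-dec _≟B_ u v
... | yes _ = refl
... | no _  = refl
≡-dec-cons false true  u v with ≡-dec _≟B_ u v
... | yes _ = refl
... | no _  = refl
≡-dec-cons true  false u v with ≡-dec _≟B_ u v
... | yes _ = refl
... | no _  = refl
≡-dec-cons true  true  u v with ≡-dec _≟B_ u v
... | yes _ = refl
... | no _  = refl

≡-dec≡=ᵛ : ∀ {n} (u v : V n) → ⌊ ≡-dec _≟B_ u v ⌋ ≡ (u =ᵛ v)
≡-dec≡=ᵛ []      []      = refl
≡-dec≡=ᵛ (a ∷ u) (b ∷ v) rewrite ≡-dec-cons a b u v | ≡-dec≡=ᵛ u v = refl

=ᵛ-sound : ∀ {n} (u w : V n) → (u =ᵛ w) ≡ true → u ≡ w
=ᵛ-sound []          []          _ = refl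
=ᵛ-sound (false ∷ u) (false ∷ w) e = cong (false ∷_) (=ᵛ-sound u w e)
=ᵛ-sound (true ∷ u)  (true ∷ w)  e = cong (true ∷_) (=ᵛ-sound u w e)

=ᵛ-sym : ∀ {n} (u w : V n) → (u =ᵛ w) ≡ (w =ᵛ u)
=ᵛ-sym []          []          = refl
=ᵛ-sym (false ∷ u) (false ∷ w) = =ᵛ-sym u w
=ᵛ-sym (true ∷ u)  (true ∷ w)  = =ᵛ-sym u w
=ᵛ-sym (false ∷ u) (true ∷ w)  = refl
=ᵛ-sym (true ∷ u)  (false ∷ w) = refl

ΣV : (n : ℕ) → (V n → ℚ) → ℚ
ΣV n = sumL (allStrings n)

N : ℕ → ℚ
N n = ι (2 ℕ.^ n)

N-suc : ∀ n → N (suc n) ≡ N n + N n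
N-suc n = trans (ι-+ (2 ℕ.^ n) (2 ℕ.^ n ℕ.+ 0)) (cong (λ z → N n + ι z) (ℕP.+-identityʳ (2 ℕ.^ n)))

N*inv : ∀ n → N n * inv (2 ℕ.^ n) ≡ 1ℚ
N*inv n = ι*inv (2 ℕ.^ n) {{ℕP.m^n≢0 2 n}}

ΣV-suc : ∀ n (f : V (suc n) → ℚ) → ΣV (suc n) f ≡ ΣV n (λ v → f (false ∷ v)) + ΣV n (λ v → f (true ∷ v))
ΣV-suc n f = trans (sum-++ (lmap (false ∷_) (allStrings n)) _ f)
  (cong₂ _+_ (sum-map (false ∷_) (allStrings n) f) (sum-map (true ∷_) (allStrings n) f))

ΣV-cong : ∀ n {f g : V n → ℚ} → (∀ v → f v ≡ g v) → ΣV n f ≡ ΣV n g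
ΣV-cong n = sum-cong (allStrings n)

ΣV-const : ∀ n c → ΣV n (λ _ → c) ≡ c * N n
ΣV-const zero    c = trans (QP.+-identityʳ c) (sym (QP.*-identityʳ c))
ΣV-const (suc n) c = begin
  ΣV (suc n) (λ _ → c)   ≡⟨ ΣV-suc n (λ _ → c) ⟩
  ΣV n (λ _ → c) + ΣV n (λ _ → c) ≡⟨ cong (λ z → z + z) (ΣV-const n c) ⟩
  c * N n + c * N n      ≡⟨ sym (QP.*-distribˡ-+ c (N n) (N n)) ⟩
  c * (N n + N n)        ≡⟨ cong (c *_) (sym (N-suc n)) ⟩
  c * N (suc n)          ∎
  where open ≡-Reasoning

-- Translation invariance of the counting measure: v ↦ v ⊕ m is a bijection.
ΣV-translate : ∀ n (m : V n) (f : V n → ℚ) → ΣV n (λ v → f (v ⊕ m)) ≡ ΣV n f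
ΣV-translate zero    []          f = refl
ΣV-translate (suc n) (false ∷ m) f
  rewrite ΣV-suc n (λ v → f (v ⊕ (false ∷ m))) | ΣV-suc n f
        | ΣV-translate n m (λ v → f (false ∷ v)) | ΣV-translate n m (λ v → f (true ∷ v)) = refl
ΣV-translate (suc n) (true ∷ m)  f
  rewrite ΣV-suc n (λ v → f (v ⊕ (true ∷ m))) | ΣV-suc n f
        | ΣV-translate n m (λ v → f (true ∷ v)) | ΣV-translate n m (λ v → f (false ∷ v)) =
  QP.+-comm (ΣV n (λ v → f (true ∷ v))) (ΣV n (λ v → f (false ∷ v)))

ΣV-point : ∀ n (i : V n) (f : V n → ℚ) → ΣV n (λ v → if i =ᵛ v then f v else 0ℚ) ≡ f i
ΣV-point zero    []          f = QP.+-identityʳ (f [])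
ΣV-point (suc n) (false ∷ i) f = begin
  ΣV (suc n) (λ v → if (false ∷ i) =ᵛ v then f v else 0ℚ)
    ≡⟨ ΣV-suc n (λ v → if (false ∷ i) =ᵛ v then f v else 0ℚ) ⟩
  ΣV n (λ v → if i =ᵛ v then f (false ∷ v) else 0ℚ) + ΣV n (λ _ → 0ℚ)
    ≡⟨ cong₂ _+_ (ΣV-point n i (λ v → f (false ∷ v))) (sum-0 (allStrings n)) ⟩
  f (false ∷ i) + 0ℚ   ≡⟨ QP.+-identityʳ _ ⟩
  f (false ∷ i)        ∎
  where open ≡-Reasoning
ΣV-point (suc n) (true ∷ i)  f = begin
  ΣV (suc n) (λ v → if (true ∷ i) =ᵛ v then f v else 0ℚ)
    ≡⟨ ΣV-suc n (λ v → if (true ∷ i) =ᵛ v then f v else 0ℚ) ⟩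
  ΣV n (λ _ → 0ℚ) + ΣV n (λ v → if i =ᵛ v then f (true ∷ v) else 0ℚ)
    ≡⟨ cong₂ _+_ (sum-0 (allStrings n)) (ΣV-point n i (λ v → f (true ∷ v))) ⟩
  0ℚ + f (true ∷ i)    ≡⟨ QP.+-identityˡ _ ⟩
  f (true ∷ i)         ∎
  where open ≡-Reasoning

ΣV-δ : ∀ n (i : V n) (f : V n → ℚ) → ΣV n (λ v → δ i v * f v) ≡ f i
ΣV-δ n i f = trans (ΣV-cong n (λ v → trans (ind (⌊ ≡-dec _≟B_ i v ⌋) (f v))
                                            (cong (λ e → if e then f v else 0ℚ) (≡-dec≡=ᵛ i v))))
                   (ΣV-point n i f)
  where
  ind : ∀ b q → (if b then 1ℚ else 0ℚ) * q ≡ (if b then q else 0ℚ)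
  ind false q = QP.*-zeroˡ q
  ind true  q = QP.*-identityˡ q

-- Characters of (ℤ/2)ⁿ: χ S v = (-1)^⟨S,v⟩.  The Fourier basis in which the
-- Laplacian of every Cayley graph on the cube is diagonal.

sign : Bool → ℚ
sign false = 1ℚ
sign true  = - 1ℚ

χ : ∀ {n} → V n → V n → ℚ
χ []      []      = 1ℚ
χ (s ∷ S) (v ∷ w) = sign (s ∧ v) * χ S w

⟨_,_⟩ : ∀ {n} → V n → V n → Bool
⟨ []    , []    ⟩ = false
⟨ s ∷ S , v ∷ w ⟩ = (s ∧ v) xor ⟨ S , w ⟩

χ≡sign : ∀ {n} (S v : V n) → χ S v ≡ sign ⟨ S , v ⟩
χ≡sign []      []      = refl
χ≡sign (s ∷ S) (v ∷ w) rewrite χ≡sign S w with s ∧ v | ⟨ S , w ⟩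
... | false | false = refl
... | false | true  = QP.*-identityˡ _
... | true  | false = QP.*-identityʳ _
... | true  | true  = refl

sign-xor : ∀ a b → sign (a xor b) ≡ sign a * sign b
sign-xor false b     = sym (QP.*-identityˡ (sign b))
sign-xor true  false = refl
sign-xor true  true  = refl

χ-⊕ : ∀ {n} (S v m : V n) → χ S (v ⊕ m) ≡ χ S v * χ S m
χ-⊕ []      []      []      = refl
χ-⊕ (s ∷ S) (a ∷ v) (b ∷ m) rewrite χ-⊕ S v m | ∧-distribˡ-xor s a b | sign-xor (s ∧ a) (s ∧ b) =
  solve 4 (λ x y z w → (x :* y) :* (z :* w) := (x :* z) :* (y :* w)) refl
    (sign (s ∧ a)) (sign (s ∧ b)) (χ S v) (χ S m)

χ-zeros : ∀ {n} (S : V n) → χ S (zeros n) ≡ 1ℚ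
χ-zeros []      = refl
χ-zeros (false ∷ S) rewrite χ-zeros S = refl
χ-zeros (true ∷ S)  rewrite χ-zeros S = refl

χ-sq : ∀ {n} (S v : V n) → χ S v * χ S v ≡ 1ℚ
χ-sq S v rewrite χ≡sign S v with ⟨ S , v ⟩
... | false = refl
... | true  = refl

χ-wt0 : ∀ {n} (S v : V n) → wt S ≡ 0 → χ S v ≡ 1ℚ
χ-wt0 []          []      _  = refl
χ-wt0 (false ∷ S) (v ∷ w) S0 rewrite χ-wt0 S w S0 = refl

ΣV-χ : ∀ n (S : V n) → (wt S ≡ 0 → ⊥) → ΣV n (χ S) ≡ 0ℚ
ΣV-χ zero    []          S≢0 = ⊥-elim (S≢0 refl)
ΣV-χ (suc n) (true ∷ S)  _   = begin
  ΣV (suc n) (χ (true ∷ S))  ≡⟨ ΣV-suc n (χ (true ∷ S)) ⟩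
  ΣV n (λ v → 1ℚ * χ S v) + ΣV n (λ v → (- 1ℚ) * χ S v)
    ≡⟨ cong₂ _+_ (sum-*ˡ (allStrings n) 1ℚ (χ S)) (sum-*ˡ (allStrings n) (- 1ℚ) (χ S)) ⟩
  1ℚ * ΣV n (χ S) + (- 1ℚ) * ΣV n (χ S)
    ≡⟨ solve 1 (λ x → con 1ℚ :* x :+ con (- 1ℚ) :* x := con 0ℚ) refl (ΣV n (χ S)) ⟩
  0ℚ ∎
  where open ≡-Reasoning
ΣV-χ (suc n) (false ∷ S) S≢0 = begin
  ΣV (suc n) (χ (false ∷ S))  ≡⟨ ΣV-suc n (χ (false ∷ S)) ⟩
  ΣV n (λ v → 1ℚ * χ S v) + ΣV n (λ v → 1ℚ * χ S v)
    ≡⟨ cong (λ z → z + z) (trans (sum-*ˡ (allStrings n) 1ℚ (χ S)) (QP.*-identityˡ (ΣV n (χ S)))) ⟩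
  ΣV n (χ S) + ΣV n (χ S)     ≡⟨ cong (λ z → z + z) (ΣV-χ n S S≢0) ⟩
  0ℚ ∎
  where open ≡-Reasoning

orthogonality : ∀ n (i v : V n) → ΣV n (λ S → χ S i * χ S v) ≡ (if i =ᵛ v then N n else 0ℚ)
orthogonality zero    []      []      = refl
orthogonality (suc n) (a ∷ i) (b ∷ v) = begin
  ΣV (suc n) (λ S → χ S (a ∷ i) * χ S (b ∷ v))
    ≡⟨ ΣV-suc n (λ S → χ S (a ∷ i) * χ S (b ∷ v)) ⟩
  ΣV n (λ S → (1ℚ * χ S i) * (1ℚ * χ S v)) + ΣV n (λ S → (sign a * χ S i) * (sign b * χ S v))
    ≡⟨ cong₂ _+_ (trans (ΣV-cong n (λ S → solve 2 (λ x y → (con 1ℚ :* x) :* (con 1ℚ :* y) := x :* y) refl (χ S i) (χ S v)))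
                        (orthogonality n i v))
                 (trans (ΣV-cong n (λ S → solve 4 (λ p q x y → (p :* x) :* (q :* y) := (p :* q) :* (x :* y)) refl
                                               (sign a) (sign b) (χ S i) (χ S v)))
                        (trans (sum-*ˡ (allStrings n) (sign a * sign b) (λ S → χ S i * χ S v))
                               (cong (sign a * sign b *_) (orthogonality n i v)))) ⟩
  E + sign a * sign b * E   ≡⟨ step a b (i =ᵛ v) ⟩
  (if (a ∷ i) =ᵛ (b ∷ v) then N (suc n) else 0ℚ) ∎
  where
  open ≡-Reasoning
  E = if i =ᵛ v then N n else 0ℚ
  step : ∀ a b e → (if e then N n else 0ℚ) + sign a * sign b * (if e then N n else 0ℚ)
                   ≡ (if (a =ᵇ b) ∧ e then N (suc n) else 0ℚ)
  step false false true  = trans (cong (N n +_) (QP.*-identityˡ (N n))) (sym (N-suc n))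
  step true  true  true  = trans (cong (N n +_) (QP.*-identityˡ (N n))) (sym (N-suc n))
  step false true  true  = solve 1 (λ x → x :+ con 1ℚ :* con (- 1ℚ) :* x := con 0ℚ) refl (N n)
  step true  false true  = solve 1 (λ x → x :+ con (- 1ℚ) :* con 1ℚ :* x := con 0ℚ) refl (N n)
  step false false false = refl
  step false true  false = refl
  step true  false false = refl
  step true  true  false = refl

fourier : ∀ {n} → (V n → ℚ) → V n → ℚ
fourier {n} x S = ΣV n (λ v → x v * χ S v)

fourier-inversion : ∀ n (x : V n → ℚ) i → x i * N n ≡ ΣV n (λ S → χ S i * fourier x S)
fourier-inversion n x i = sym (begin
  ΣV n (λ S → χ S i * fourier x S)
    ≡⟨ ΣV-cong n (λ S → sym (sum-*ˡ (allStrings n) (χ S i) (λ v → x v * χ S v))) ⟩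
  ΣV n (λ S → ΣV n (λ v → χ S i * (x v * χ S v)))
    ≡⟨ sum-swap (allStrings n) (allStrings n) (λ S v → χ S i * (x v * χ S v)) ⟩
  ΣV n (λ v → ΣV n (λ S → χ S i * (x v * χ S v)))
    ≡⟨ ΣV-cong n (λ v → trans (ΣV-cong n (λ S → solve 3 (λ a b c → a :* (b :* c) := b :* (a :* c)) refl (χ S i) (x v) (χ S v)))
                               (sum-*ˡ (allStrings n) (x v) (λ S → χ S i * χ S v))) ⟩
  ΣV n (λ v → x v * ΣV n (λ S → χ S i * χ S v))
    ≡⟨ ΣV-cong n (λ v → trans (cong (x v *_) (orthogonality n i v)) (pull (i =ᵛ v) (x v))) ⟩
  ΣV n (λ v → if i =ᵛ v then x v * N n else 0ℚ)
    ≡⟨ ΣV-point n i (λ v → x v * N n) ⟩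
  x i * N n ∎)
  where
  open ≡-Reasoning
  pull : ∀ b q → q * (if b then N n else 0ℚ) ≡ (if b then q * N n else 0ℚ)
  pull false q = QP.*-zeroʳ q
  pull true  q = refl

-- Its Laplacian is diagonalised by the characters: χ_S is
-- an eigenvector with eigenvalue Σ_{m ∈ gs} (1 - χ_S(m)).

cayleyLaplacian : ∀ {n} → List (V n) → (V n → ℚ) → V n → ℚ
cayleyLaplacian gs x v = sumL gs (λ m → x v - x (v ⊕ m))

cayleyEigenvalue : ∀ {n} → List (V n) → V n → ℚ
cayleyEigenvalue gs S = sumL gs (λ m → 1ℚ - χ S m)

fourier-translate : ∀ n (x : V n → ℚ) (S m : V n) → fourier (λ v → x (v ⊕ m)) S ≡ χ S m * fourier x S
fourier-translate n x S m = begin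
  ΣV n (λ v → x (v ⊕ m) * χ S v)
    ≡⟨ ΣV-cong n (λ v → cong (λ z → x (v ⊕ m) * χ S z) (sym (⊕-invol v m))) ⟩
  ΣV n (λ v → x (v ⊕ m) * χ S ((v ⊕ m) ⊕ m))
    ≡⟨ ΣV-translate n m (λ u → x u * χ S (u ⊕ m)) ⟩
  ΣV n (λ u → x u * χ S (u ⊕ m))
    ≡⟨ ΣV-cong n (λ u → trans (cong (x u *_) (χ-⊕ S u m))
                              (solve 3 (λ a b c → a :* (b :* c) := c :* (a :* b)) refl (x u) (χ S u) (χ S m))) ⟩
  ΣV n (λ u → χ S m * (x u * χ S u))
    ≡⟨ sum-*ˡ (allStrings n) (χ S m) (λ u → x u * χ S u) ⟩
  χ S m * fourier x S ∎
  where open ≡-Reasoning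

fourier-cayleyLaplacian : ∀ n (gs : List (V n)) (x : V n → ℚ) S →
  fourier (cayleyLaplacian gs x) S ≡ cayleyEigenvalue gs S * fourier x S
fourier-cayleyLaplacian n gs x S = begin
  ΣV n (λ v → cayleyLaplacian gs x v * χ S v)
    ≡⟨ ΣV-cong n (λ v → sym (sum-*ʳ gs (χ S v) (λ m → x v - x (v ⊕ m)))) ⟩
  ΣV n (λ v → sumL gs (λ m → (x v - x (v ⊕ m)) * χ S v))
    ≡⟨ sum-swap (allStrings n) gs (λ v m → (x v - x (v ⊕ m)) * χ S v) ⟩
  sumL gs (λ m → ΣV n (λ v → (x v - x (v ⊕ m)) * χ S v))
    ≡⟨ sum-cong gs per-generator ⟩
  sumL gs (λ m → (1ℚ - χ S m) * fourier x S)
    ≡⟨ sum-*ʳ gs (fourier x S) (λ m → 1ℚ - χ S m) ⟩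
  cayleyEigenvalue gs S * fourier x S ∎
  where
  open ≡-Reasoning
  X = fourier x S
  per-generator : ∀ m → ΣV n (λ v → (x v - x (v ⊕ m)) * χ S v) ≡ (1ℚ - χ S m) * X
  per-generator m = begin
    ΣV n (λ v → (x v - x (v ⊕ m)) * χ S v)
      ≡⟨ ΣV-cong n (λ v → solve 3 (λ a b c → (a :- b) :* c := a :* c :- b :* c) refl (x v) (x (v ⊕ m)) (χ S v)) ⟩
    ΣV n (λ v → x v * χ S v - x (v ⊕ m) * χ S v)
      ≡⟨ sum-- (allStrings n) (λ v → x v * χ S v) (λ v → x (v ⊕ m) * χ S v) ⟩
    X - fourier (λ v → x (v ⊕ m)) S
      ≡⟨ cong (λ z → X - z) (fourier-translate n x S m) ⟩
    X - χ S m * X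
      ≡⟨ solve 2 (λ a c → a :- c :* a := (con 1ℚ :- c) :* a) refl X (χ S m) ⟩
    (1ℚ - χ S m) * X ∎

fourier-source : ∀ n (i j S : V n) → fourier (λ v → δ i v - δ j v) S ≡ χ S i - χ S j
fourier-source n i j S = begin
  ΣV n (λ v → (δ i v - δ j v) * χ S v)
    ≡⟨ ΣV-cong n (λ v → solve 3 (λ a b c → (a :- b) :* c := a :* c :- b :* c) refl (δ i v) (δ j v) (χ S v)) ⟩
  ΣV n (λ v → δ i v * χ S v - δ j v * χ S v)
    ≡⟨ sum-- (allStrings n) (λ v → δ i v * χ S v) (λ v → δ j v * χ S v) ⟩
  ΣV n (λ v → δ i v * χ S v) - ΣV n (λ v → δ j v * χ S v)
    ≡⟨ cong₂ _-_ (ΣV-δ n i (χ S)) (ΣV-δ n j (χ S)) ⟩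
  χ S i - χ S j ∎
  where open ≡-Reasoning

-- Solving ℓ·X = d for one Fourier mode: d·X = d² / ℓ, where for ℓ = 0 the
-- equation forces d = 0 and the convention 1/0 = 0 is harmless.
mode-solution : ∀ (l : ℕ) (d X : ℚ) → ι l * X ≡ d → (l ≡ 0 → d ≡ 0ℚ) → d * X ≡ d * d * inv l
mode-solution zero    d X _   d≡0 rewrite d≡0 refl = trans (QP.*-zeroˡ X) (sym (QP.*-zeroʳ (0ℚ * 0ℚ)))
mode-solution (suc l) d X lX≡d _ = begin
  d * X                    ≡⟨ cong (d *_) X≡d/l ⟩
  d * (inv (suc l) * d)    ≡⟨ solve 2 (λ a w → a :* (w :* a) := a :* a :* w) refl d (inv (suc l)) ⟩
  d * d * inv (suc l)      ∎
  where
  open ≡-Reasoning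
  X≡d/l : X ≡ inv (suc l) * d
  X≡d/l = begin
    X                          ≡⟨ sym (QP.*-identityˡ X) ⟩
    1ℚ * X                     ≡⟨ cong (_* X) (sym (inv*ι (suc l))) ⟩
    inv (suc l) * ι (suc l) * X ≡⟨ QP.*-assoc (inv (suc l)) (ι (suc l)) X ⟩
    inv (suc l) * (ι (suc l) * X) ≡⟨ cong (inv (suc l) *_) lX≡d ⟩
    inv (suc l) * d            ∎

ι≡0 : ∀ m → ι m ≡ 0ℚ → m ≡ 0
ι≡0 zero    _ = refl
ι≡0 (suc m) e = ⊥-elim (QP.<-irrefl (sym e) (0<ι m))

ΣΣ-χ-diff² : ∀ n (S : V n) → (wt S ≡ 0 → ⊥) →
  ΣV n (λ i → ΣV n (λ j → (χ S i - χ S j) * (χ S i - χ S j))) ≡ (N n + N n) * N n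
ΣΣ-χ-diff² n S S≢0 = begin
  ΣV n (λ i → ΣV n (λ j → (χ S i - χ S j) * (χ S i - χ S j)))
    ≡⟨ ΣV-cong n (λ i → ΣV-cong n (λ j → expand i j)) ⟩
  ΣV n (λ i → ΣV n (λ j → (1ℚ + 1ℚ) - (χ S i + χ S i) * χ S j))
    ≡⟨ ΣV-cong n (λ i → trans (sum-- (allStrings n) (λ _ → 1ℚ + 1ℚ) (λ j → (χ S i + χ S i) * χ S j))
                              (cong₂ _-_ (ΣV-const n (1ℚ + 1ℚ)) (trans (sum-*ˡ (allStrings n) (χ S i + χ S i) (χ S))
                                                                       (cong ((χ S i + χ S i) *_) (ΣV-χ n S S≢0))))) ⟩
  ΣV n (λ i → (1ℚ + 1ℚ) * N n - (χ S i + χ S i) * 0ℚ)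
    ≡⟨ ΣV-cong n (λ i → solve 2 (λ x c → (con 1ℚ :+ con 1ℚ) :* x :- (c :+ c) :* con 0ℚ := x :+ x) refl (N n) (χ S i)) ⟩
  ΣV n (λ _ → N n + N n)   ≡⟨ ΣV-const n (N n + N n) ⟩
  (N n + N n) * N n ∎
  where
  open ≡-Reasoning
  expand : ∀ i j → (χ S i - χ S j) * (χ S i - χ S j) ≡ (1ℚ + 1ℚ) - (χ S i + χ S i) * χ S j
  expand i j = begin
    (χ S i - χ S j) * (χ S i - χ S j)
      ≡⟨ solve 2 (λ a b → (a :- b) :* (a :- b) := a :* a :+ b :* b :- (a :+ a) :* b) refl (χ S i) (χ S j) ⟩
    χ S i * χ S i + χ S j * χ S j - (χ S i + χ S i) * χ S j
      ≡⟨ cong₂ (λ u v → u + v - (χ S i + χ S i) * χ S j) (χ-sq S i) (χ-sq S j) ⟩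
    (1ℚ + 1ℚ) - (χ S i + χ S i) * χ S j ∎

module CayleySpectrum {n : ℕ} (gs : List (V n)) (ev : V n → ℕ)
  (ev-spec : ∀ S → ι (ev S) ≡ cayleyEigenvalue gs S)
  (connected : ∀ S → ev S ≡ 0 → wt S ≡ 0) where

  -- 2ⁿ · r_ij, in spectral form.
  ρ : V n → V n → ℚ
  ρ i j = ΣV n (λ S → (χ S i - χ S j) * (χ S i - χ S j) * inv (ev S))

  resistance-formula : ∀ (x : V n → ℚ) i j → (∀ v → cayleyLaplacian gs x v ≡ δ i v - δ j v) →
                       (x i - x j) * N n ≡ ρ i j
  resistance-formula x i j Lx≡δ = begin
    (x i - x j) * N n
      ≡⟨ solve 3 (λ a b c → (a :- b) :* c := a :* c :- b :* c) refl (x i) (x j) (N n) ⟩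
    x i * N n - x j * N n
      ≡⟨ cong₂ _-_ (fourier-inversion n x i) (fourier-inversion n x j) ⟩
    ΣV n (λ S → χ S i * fourier x S) - ΣV n (λ S → χ S j * fourier x S)
      ≡⟨ sym (sum-- (allStrings n) (λ S → χ S i * fourier x S) (λ S → χ S j * fourier x S)) ⟩
    ΣV n (λ S → χ S i * fourier x S - χ S j * fourier x S)
      ≡⟨ ΣV-cong n (λ S → trans (solve 3 (λ a b c → a :* c :- b :* c := (a :- b) :* c) refl (χ S i) (χ S j) (fourier x S))
                                (mode-solution (ev S) _ _ (coefficient S) (trivial-mode S))) ⟩
    ρ i j ∎
    where
    open ≡-Reasoning
    coefficient : ∀ S → ι (ev S) * fourier x S ≡ χ S i - χ S j
    coefficient S = begin
      ι (ev S) * fourier x S                   ≡⟨ cong (_* fourier x S) (ev-spec S) ⟩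
      cayleyEigenvalue gs S * fourier x S      ≡⟨ sym (fourier-cayleyLaplacian n gs x S) ⟩
      fourier (cayleyLaplacian gs x) S         ≡⟨ ΣV-cong n (λ v → cong (_* χ S v) (Lx≡δ v)) ⟩
      fourier (λ v → δ i v - δ j v) S          ≡⟨ fourier-source n i j S ⟩
      χ S i - χ S j ∎
    trivial-mode : ∀ S → ev S ≡ 0 → χ S i - χ S j ≡ 0ℚ
    trivial-mode S e rewrite χ-wt0 S i (connected S e) | χ-wt0 S j (connected S e) = refl

  W : ℚ
  W = ΣV n (λ S → inv (ev S))

  ev-trivial : ∀ S → wt S ≡ 0 → ev S ≡ 0
  ev-trivial S S0 = ι≡0 (ev S) (trans (ev-spec S)
    (trans (sum-cong gs (λ m → cong (λ z → 1ℚ - z) (χ-wt0 S m S0))) (sum-0 gs)))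

  ΣΣρ : ΣV n (λ i → ΣV n (ρ i)) ≡ ((N n + N n) * N n) * W
  ΣΣρ = begin
    ΣV n (λ i → ΣV n (λ j → ΣV n (λ S → term S i j)))
      ≡⟨ ΣV-cong n (λ i → sum-swap (allStrings n) (allStrings n) (λ j S → term S i j)) ⟩
    ΣV n (λ i → ΣV n (λ S → ΣV n (λ j → term S i j)))
      ≡⟨ sum-swap (allStrings n) (allStrings n) (λ i S → ΣV n (λ j → term S i j)) ⟩
    ΣV n (λ S → ΣV n (λ i → ΣV n (λ j → term S i j)))
      ≡⟨ ΣV-cong n per-mode ⟩
    ΣV n (λ S → ((N n + N n) * N n) * inv (ev S))
      ≡⟨ sum-*ˡ (allStrings n) ((N n + N n) * N n) (λ S → inv (ev S)) ⟩
    ((N n + N n) * N n) * W ∎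
    where
    open ≡-Reasoning
    term : V n → V n → V n → ℚ
    term S i j = (χ S i - χ S j) * (χ S i - χ S j) * inv (ev S)
    D : V n → ℚ
    D S = ΣV n (λ i → ΣV n (λ j → (χ S i - χ S j) * (χ S i - χ S j)))
    by-case : ∀ S (l : ℕ) → ev S ≡ l → D S * inv l ≡ ((N n + N n) * N n) * inv l
    by-case S zero    _ = trans (QP.*-zeroʳ (D S)) (sym (QP.*-zeroʳ ((N n + N n) * N n)))
    by-case S (suc l) e = cong (_* inv (suc l))
      (ΣΣ-χ-diff² n S (λ S0 → ℕP.0≢1+n (trans (sym (ev-trivial S S0)) e)))
    per-mode : ∀ S → ΣV n (λ i → ΣV n (λ j → term S i j)) ≡ ((N n + N n) * N n) * inv (ev S)
    per-mode S = begin
      ΣV n (λ i → ΣV n (λ j → term S i j))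
        ≡⟨ ΣV-cong n (λ i → sum-*ʳ (allStrings n) (inv (ev S)) (λ j → (χ S i - χ S j) * (χ S i - χ S j))) ⟩
      ΣV n (λ i → ΣV n (λ j → (χ S i - χ S j) * (χ S i - χ S j)) * inv (ev S))
        ≡⟨ sum-*ʳ (allStrings n) (inv (ev S)) (λ i → ΣV n (λ j → (χ S i - χ S j) * (χ S i - χ S j))) ⟩
      D S * inv (ev S)
        ≡⟨ by-case S (ev S) refl ⟩
      ((N n + N n) * N n) * inv (ev S) ∎

  kirchhoff-formula : ∀ r → (∀ i j → r i j * N n ≡ ρ i j) → kirchhoff n r ≡ N n * W
  kirchhoff-formula r r≡ρ = ι-cancelʳ (kirchhoff n r) (N n * W) (2 ℕ.^ suc n) {{ℕP.m^n≢0 2 (suc n)}} (begin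
    kirchhoff n r * N (suc n)          ≡⟨ cong (kirchhoff n r *_) (N-suc n) ⟩
    kirchhoff n r * (N n + N n)        ≡⟨ QP.*-distribˡ-+ (kirchhoff n r) (N n) (N n) ⟩
    kirchhoff n r * N n + kirchhoff n r * N n ≡⟨ cong (λ z → z + z) Kf·2ⁿ ⟩
    P + P                              ≡⟨ sym (sum-pairsLT (allStrings n) ρ ρ-diag ρ-sym) ⟩
    ΣV n (λ i → ΣV n (ρ i))            ≡⟨ ΣΣρ ⟩
    ((N n + N n) * N n) * W            ≡⟨ solve 2 (λ x w → ((x :+ x) :* x) :* w := x :* w :* (x :+ x)) refl (N n) W ⟩
    N n * W * (N n + N n)              ≡⟨ cong (N n * W *_) (sym (N-suc n)) ⟩
    N n * W * N (suc n)                ∎)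
    where
    open ≡-Reasoning
    pairs = pairsLT (allStrings n)
    P = sumL pairs (λ p → ρ (proj₁ p) (proj₂ p))
    Kf·2ⁿ : kirchhoff n r * N n ≡ P
    Kf·2ⁿ = trans (sym (sum-*ʳ pairs (N n) (λ p → r (proj₁ p) (proj₂ p))))
                  (sum-cong pairs (λ p → r≡ρ (proj₁ p) (proj₂ p)))
    ρ-diag : ∀ a → ρ a a ≡ 0ℚ
    ρ-diag a = trans (ΣV-cong n (λ S → solve 2 (λ x w → (x :- x) :* (x :- x) :* w := con 0ℚ) refl (χ S a) (inv (ev S))))
                     (sum-0 (allStrings n))
    ρ-sym : ∀ a b → ρ a b ≡ ρ b a
    ρ-sym a b = ΣV-cong n (λ S → solve 3 (λ x y w → (x :- y) :* (x :- y) :* w := (y :- x) :* (y :- x) :* w) refl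
                                       (χ S a) (χ S b) (inv (ev S)))

units : (n : ℕ) → List (V n)
units zero    = []
units (suc n) = (true ∷ zeros n) ∷ lmap (false ∷_) (units n)

tailMask : ℕ → (n : ℕ) → V n
tailMask zero    n       = replicate n true
tailMask (suc m) zero    = []
tailMask (suc m) (suc n) = false ∷ tailMask m n

keepFlip≡⊕ : ∀ m {n} (v : V n) → keepFlip m v ≡ v ⊕ tailMask m n
keepFlip≡⊕ zero    []          = refl
keepFlip≡⊕ zero    (false ∷ v) = cong (true ∷_) (keepFlip≡⊕ zero v)
keepFlip≡⊕ zero    (true ∷ v)  = cong (false ∷_) (keepFlip≡⊕ zero v)
keepFlip≡⊕ (suc m) []          = refl
keepFlip≡⊕ (suc m) (false ∷ v) = cong (false ∷_) (keepFlip≡⊕ m v)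
keepFlip≡⊕ (suc m) (true ∷ v)  = cong (true ∷_) (keepFlip≡⊕ m v)

wt-tailMask : ∀ m n → wt (tailMask m n) ≡ n ∸ m
wt-tailMask zero    zero    = refl
wt-tailMask zero    (suc n) = cong suc (wt-tailMask zero n)
wt-tailMask (suc m) zero    = refl
wt-tailMask (suc m) (suc n) = wt-tailMask m n

generators : (n k : ℕ) → List (V n)
generators n k = units n ++ (tailMask (k ∸ 1) n ∷ [])

ΣV-hamming0 : ∀ n (v : V n) (g : V n → ℚ) → ΣV n (λ u → if hamming v u ≡ᵇ 0 then g u else 0ℚ) ≡ g v
ΣV-hamming0 zero    []          g = QP.+-identityʳ (g [])
ΣV-hamming0 (suc n) (false ∷ v) g = trans (ΣV-suc n (λ u → if hamming (false ∷ v) u ≡ᵇ 0 then g u else 0ℚ))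
  (trans (cong₂ _+_ (ΣV-hamming0 n v (λ u → g (false ∷ u))) (sum-0 (allStrings n))) (QP.+-identityʳ (g (false ∷ v))))
ΣV-hamming0 (suc n) (true ∷ v)  g = trans (ΣV-suc n (λ u → if hamming (true ∷ v) u ≡ᵇ 0 then g u else 0ℚ))
  (trans (cong₂ _+_ (sum-0 (allStrings n)) (ΣV-hamming0 n v (λ u → g (true ∷ u)))) (QP.+-identityˡ (g (true ∷ v))))

ΣV-hamming1 : ∀ n (v : V n) (g : V n → ℚ) →
  ΣV n (λ u → if hamming v u ≡ᵇ 1 then g u else 0ℚ) ≡ sumL (units n) (λ m → g (v ⊕ m))
ΣV-hamming1 zero    []          g = refl
ΣV-hamming1 (suc n) (false ∷ v) g = begin
  ΣV (suc n) (λ u → if hamming (false ∷ v) u ≡ᵇ 1 then g u else 0ℚ)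
    ≡⟨ ΣV-suc n (λ u → if hamming (false ∷ v) u ≡ᵇ 1 then g u else 0ℚ) ⟩
  ΣV n (λ u → if hamming v u ≡ᵇ 1 then g (false ∷ u) else 0ℚ) + ΣV n (λ u → if hamming v u ≡ᵇ 0 then g (true ∷ u) else 0ℚ)
    ≡⟨ cong₂ _+_ (ΣV-hamming1 n v (λ u → g (false ∷ u))) (ΣV-hamming0 n v (λ u → g (true ∷ u))) ⟩
  sumL (units n) (λ m → g (false ∷ (v ⊕ m))) + g (true ∷ v)
    ≡⟨ QP.+-comm _ (g (true ∷ v)) ⟩
  g (true ∷ v) + sumL (units n) (λ m → g (false ∷ (v ⊕ m)))
    ≡⟨ cong₂ _+_ (cong (λ z → g (true ∷ z)) (sym (⊕-zeros v))) (sym (sum-map (false ∷_) (units n) (λ m → g ((false ∷ v) ⊕ m)))) ⟩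
  sumL (units (suc n)) (λ m → g ((false ∷ v) ⊕ m)) ∎
  where open ≡-Reasoning
ΣV-hamming1 (suc n) (true ∷ v)  g = begin
  ΣV (suc n) (λ u → if hamming (true ∷ v) u ≡ᵇ 1 then g u else 0ℚ)
    ≡⟨ ΣV-suc n (λ u → if hamming (true ∷ v) u ≡ᵇ 1 then g u else 0ℚ) ⟩
  ΣV n (λ u → if hamming v u ≡ᵇ 0 then g (false ∷ u) else 0ℚ) + ΣV n (λ u → if hamming v u ≡ᵇ 1 then g (true ∷ u) else 0ℚ)
    ≡⟨ cong₂ _+_ (ΣV-hamming0 n v (λ u → g (false ∷ u))) (ΣV-hamming1 n v (λ u → g (true ∷ u))) ⟩
  g (false ∷ v) + sumL (units n) (λ m → g (true ∷ (v ⊕ m)))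
    ≡⟨ cong₂ _+_ (cong (λ z → g (false ∷ z)) (sym (⊕-zeros v))) (sym (sum-map (false ∷_) (units n) (λ m → g ((true ∷ v) ⊕ m)))) ⟩
  sumL (units (suc n)) (λ m → g ((true ∷ v) ⊕ m)) ∎
  where open ≡-Reasoning

if-∨ : ∀ (A B : Bool) (g : ℚ) → (B ≡ true → A ≡ false) →
       (if A ∨ B then g else 0ℚ) ≡ (if A then g else 0ℚ) + (if B then g else 0ℚ)
if-∨ false false g _ = refl
if-∨ false true  g _ = sym (QP.+-identityˡ g)
if-∨ true  false g _ = sym (QP.+-identityʳ g)
if-∨ true  true  g excl with excl refl
... | ()

-- When the complemented tail has length ≥ 2 (i.e. 1 ≤ k ≤ n-1), the special
-- neighbour is never a Hamming neighbour, and the Laplacian of Q_{n,k} is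
-- the Cayley Laplacian for `generators n k`.
laplacian≡cayley : ∀ n k → 2 ℕ.≤ n ∸ (k ∸ 1) → ∀ (x : V n → ℚ) v →
                   laplacian n k x v ≡ cayleyLaplacian (generators n k) x v
laplacian≡cayley n k tail≥2 x v = begin
  laplacian n k x v
    ≡⟨ ΣV-cong n (λ u → if-∨ (hamming v u ≡ᵇ 1) (isSpecial u) (x v - x u) (special-not-unit u)) ⟩
  ΣV n (λ u → (if hamming v u ≡ᵇ 1 then x v - x u else 0ℚ) + (if isSpecial u then x v - x u else 0ℚ))
    ≡⟨ sum-+ (allStrings n) (λ u → if hamming v u ≡ᵇ 1 then x v - x u else 0ℚ) (λ u → if isSpecial u then x v - x u else 0ℚ) ⟩
  ΣV n (λ u → if hamming v u ≡ᵇ 1 then x v - x u else 0ℚ) + ΣV n (λ u → if isSpecial u then x v - x u else 0ℚ)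
    ≡⟨ cong₂ _+_ (ΣV-hamming1 n v (λ u → x v - x u)) special-term ⟩
  sumL (units n) (λ m → x v - x (v ⊕ m)) + ((x v - x (v ⊕ t)) + 0ℚ)
    ≡⟨ sym (sum-++ (units n) (t ∷ []) (λ m → x v - x (v ⊕ m))) ⟩
  cayleyLaplacian (generators n k) x v ∎
  where
  open ≡-Reasoning
  t = tailMask (k ∸ 1) n
  w = complTail k v
  w≡ : w ≡ v ⊕ t
  w≡ = keepFlip≡⊕ (k ∸ 1) v
  isSpecial : V n → Bool
  isSpecial u = ⌊ ≡-dec _≟B_ u w ⌋
  ≥2⇒≢1 : ∀ d → 2 ℕ.≤ d → (d ≡ᵇ 1) ≡ false
  ≥2⇒≢1 (suc (suc d)) _ = refl
  ≥2⇒≢1 (suc zero) (ℕ.s≤s ())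
  special-not-unit : ∀ u → isSpecial u ≡ true → (hamming v u ≡ᵇ 1) ≡ false
  special-not-unit u e with =ᵛ-sound u w (trans (sym (≡-dec≡=ᵛ u w)) e)
  ... | refl rewrite w≡ | hamming-⊕ v t | wt-tailMask (k ∸ 1) n = ≥2⇒≢1 (n ∸ (k ∸ 1)) tail≥2
  special-term : ΣV n (λ u → if isSpecial u then x v - x u else 0ℚ) ≡ (x v - x (v ⊕ t)) + 0ℚ
  special-term = trans (ΣV-cong n (λ u → cong (λ e → if e then x v - x u else 0ℚ) (trans (≡-dec≡=ᵛ u w) (=ᵛ-sym u w))))
    (trans (ΣV-point n w (λ u → x v - x u)) (trans (cong (λ z → x v - x z) w≡) (sym (QP.+-identityʳ _))))

eigenvalue : (n k : ℕ) → V n → ℕ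
eigenvalue n k S = (wt S ℕ.+ wt S) ℕ.+ (if ⟨ S , tailMask (k ∸ 1) n ⟩ then 2 else 0)

units-eigenvalue : ∀ {n} (S : V n) → sumL (units n) (λ m → 1ℚ - χ S m) ≡ ι (wt S ℕ.+ wt S)
units-eigenvalue []                = refl
units-eigenvalue {suc n} (s ∷ S) = begin
  (1ℚ - sign (s ∧ true) * χ S (zeros n)) + sumL (lmap (false ∷_) (units n)) (λ m → 1ℚ - χ (s ∷ S) m)
    ≡⟨ cong₂ _+_ (cong (λ z → 1ℚ - sign (s ∧ true) * z) (χ-zeros S)) (sum-map (false ∷_) (units n) (λ m → 1ℚ - χ (s ∷ S) m)) ⟩
  (1ℚ - sign (s ∧ true) * 1ℚ) + sumL (units n) (λ m → 1ℚ - sign (s ∧ false) * χ S m)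
    ≡⟨ cong₂ _+_ (head s) (trans (sum-cong (units n) (λ m → cong (λ z → 1ℚ - z) (untouched m))) (units-eigenvalue S)) ⟩
  ι (c ℕ.+ c) + ι (wt S ℕ.+ wt S)  ≡⟨ sym (ι-+ (c ℕ.+ c) (wt S ℕ.+ wt S)) ⟩
  ι ((c ℕ.+ c) ℕ.+ (wt S ℕ.+ wt S)) ≡⟨ cong ι (regroup c (wt S)) ⟩
  ι ((c ℕ.+ wt S) ℕ.+ (c ℕ.+ wt S)) ∎
  where
  open ≡-Reasoning
  c = if s then 1 else 0
  head : ∀ s → 1ℚ - sign (s ∧ true) * 1ℚ ≡ ι ((if s then 1 else 0) ℕ.+ (if s then 1 else 0))
  head false = refl
  head true  = refl
  untouched : ∀ m → sign (s ∧ false) * χ S m ≡ χ S m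
  untouched m rewrite ∧-zeroʳ s = QP.*-identityˡ (χ S m)
  regroup : ∀ a b → (a ℕ.+ a) ℕ.+ (b ℕ.+ b) ≡ (a ℕ.+ b) ℕ.+ (a ℕ.+ b)
  regroup = solve-∀

eigenvalue-spec : ∀ n k (S : V n) → ι (eigenvalue n k S) ≡ cayleyEigenvalue (generators n k) S
eigenvalue-spec n k S = sym (begin
  sumL (units n ++ (t ∷ [])) (λ m → 1ℚ - χ S m)
    ≡⟨ sum-++ (units n) (t ∷ []) (λ m → 1ℚ - χ S m) ⟩
  sumL (units n) (λ m → 1ℚ - χ S m) + ((1ℚ - χ S t) + 0ℚ)
    ≡⟨ cong₂ _+_ (units-eigenvalue S) (trans (QP.+-identityʳ _) (cong (λ z → 1ℚ - z) (χ≡sign S t))) ⟩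
  ι (wt S ℕ.+ wt S) + (1ℚ - sign ⟨ S , t ⟩)
    ≡⟨ cong (ι (wt S ℕ.+ wt S) +_) (tail-term ⟨ S , t ⟩) ⟩
  ι (wt S ℕ.+ wt S) + ι (if ⟨ S , t ⟩ then 2 else 0)
    ≡⟨ sym (ι-+ (wt S ℕ.+ wt S) _) ⟩
  ι (eigenvalue n k S) ∎)
  where
  open ≡-Reasoning
  t = tailMask (k ∸ 1) n
  tail-term : ∀ b → 1ℚ - sign b ≡ ι (if b then 2 else 0)
  tail-term false = refl
  tail-term true  = refl

eigenvalue-connected : ∀ n k (S : V n) → eigenvalue n k S ≡ 0 → wt S ≡ 0
eigenvalue-connected n k S e = ℕP.m+n≡0⇒m≡0 (wt S) (ℕP.m+n≡0⇒m≡0 (wt S ℕ.+ wt S) e)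

W : (n k : ℕ) → ℚ
W n k = ΣV n (λ S → inv (eigenvalue n k S))

normalizedKf-spectral : ∀ n k → 2 ℕ.≤ n ∸ (k ∸ 1) → ∀ r → IsResistanceDistance n k r →
                        normalizedKf n r ≡ ι (suc n) * inv (2 ℕ.^ n) * W n k
normalizedKf-spectral n k tail≥2 r isR = begin
  kirchhoff n r * ((ℤ.+ suc n) / (2 ℕ.^ (2 ℕ.* n))) {{ℕP.m^n≢0 2 (2 ℕ.* n)}}
    ≡⟨ cong₂ _*_ (kirchhoff-formula r r≡ρ) (fraction (suc n) (2 ℕ.^ (2 ℕ.* n)) {{ℕP.m^n≢0 2 (2 ℕ.* n)}}) ⟩
  N n * W n k * (ι (suc n) * inv (2 ℕ.^ (2 ℕ.* n)))
    ≡⟨ cong (λ z → N n * W n k * (ι (suc n) * z)) (trans (cong inv 4ⁿ≡2ⁿ2ⁿ) (inv-* (2 ℕ.^ n) (2 ℕ.^ n))) ⟩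
  N n * W n k * (ι (suc n) * (inv (2 ℕ.^ n) * inv (2 ℕ.^ n)))
    ≡⟨ solve 4 (λ x w a i → x :* w :* (a :* (i :* i)) := a :* i :* w :* (x :* i)) refl (N n) (W n k) (ι (suc n)) (inv (2 ℕ.^ n)) ⟩
  ι (suc n) * inv (2 ℕ.^ n) * W n k * (N n * inv (2 ℕ.^ n))
    ≡⟨ trans (cong (ι (suc n) * inv (2 ℕ.^ n) * W n k *_) (N*inv n)) (QP.*-identityʳ _) ⟩
  ι (suc n) * inv (2 ℕ.^ n) * W n k ∎
  where
  open ≡-Reasoning
  open CayleySpectrum (generators n k) (eigenvalue n k) (eigenvalue-spec n k) (eigenvalue-connected n k)
    using (ρ; resistance-formula; kirchhoff-formula)
  4ⁿ≡2ⁿ2ⁿ : 2 ℕ.^ (2 ℕ.* n) ≡ 2 ℕ.^ n ℕ.* 2 ℕ.^ n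
  4ⁿ≡2ⁿ2ⁿ = trans (cong (2 ℕ.^_) (cong (n ℕ.+_) (ℕP.+-identityʳ n))) (ℕP.^-distribˡ-+-* 2 n n)
  r≡ρ : ∀ i j → r i j * N n ≡ ρ i j
  r≡ρ i j with isR i j
  ... | x , Lx≡δ , rij≡ = trans (cong (_* N n) rij≡)
    (resistance-formula x i j (λ v → trans (sym (laplacian≡cayley n k tail≥2 x v)) (Lx≡δ v)))

Σ< : ℕ → (ℕ → ℚ) → ℚ
Σ< zero    f = 0ℚ
Σ< (suc M) f = f 0 + Σ< M (λ s → f (suc s))

Σ<-cong : ∀ M {f g : ℕ → ℚ} → (∀ s → f s ≡ g s) → Σ< M f ≡ Σ< M g
Σ<-cong zero    f≡g = refl
Σ<-cong (suc M) f≡g = cong₂ _+_ (f≡g 0) (Σ<-cong M (λ s → f≡g (suc s)))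

Σ<-+ : ∀ M (f g : ℕ → ℚ) → Σ< M (λ s → f s + g s) ≡ Σ< M f + Σ< M g
Σ<-+ zero    f g = refl
Σ<-+ (suc M) f g rewrite Σ<-+ M (λ s → f (suc s)) (λ s → g (suc s)) =
  solve 4 (λ a b c d → (a :+ b) :+ (c :+ d) := (a :+ c) :+ (b :+ d)) refl
    (f 0) (g 0) (Σ< M (λ s → f (suc s))) (Σ< M (λ s → g (suc s)))

Σ<-*ʳ : ∀ M c (f : ℕ → ℚ) → Σ< M (λ s → f s * c) ≡ Σ< M f * c
Σ<-*ʳ zero    c f = sym (QP.*-zeroˡ c)
Σ<-*ʳ (suc M) c f rewrite Σ<-*ʳ M c (λ s → f (suc s)) = sym (QP.*-distribʳ-+ c (f 0) _)

Σ<-0 : ∀ M → Σ< M (λ _ → 0ℚ) ≡ 0ℚ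
Σ<-0 zero    = refl
Σ<-0 (suc M) rewrite Σ<-0 M = refl

-- There are C(n,s) strings of weight s.
ΣV-weight : ∀ n M (f : ℕ → ℚ) → n ℕ.< M → ΣV n (λ S → f (wt S)) ≡ Σ< M (λ s → ι (n C s) * f s)
ΣV-weight zero    (suc M) f _ = begin
  f 0 + 0ℚ                              ≡⟨ cong₂ _+_ (sym (QP.*-identityˡ (f 0))) (sym (Σ<-0 M)) ⟩
  1ℚ * f 0 + Σ< M (λ _ → 0ℚ)            ≡⟨ cong₂ (λ u v → u * f 0 + v) (sym (QP.+-identityʳ 1ℚ))
                                             (Σ<-cong M (λ s → sym (QP.*-zeroˡ (f (suc s))))) ⟩
  ι 1 * f 0 + Σ< M (λ s → 0ℚ * f (suc s)) ∎
  where open ≡-Reasoning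
ΣV-weight (suc n) (suc M) f (ℕ.s≤s n<M) = begin
  ΣV (suc n) (λ S → f (wt S))   ≡⟨ ΣV-suc n (λ S → f (wt S)) ⟩
  ΣV n (λ S → f (wt S)) + ΣV n (λ S → f (suc (wt S)))
    ≡⟨ cong₂ _+_ (ΣV-weight n (suc M) f (ℕP.m≤n⇒m≤1+n n<M)) (ΣV-weight n M (λ s → f (suc s)) n<M) ⟩
  (ι 1 * f 0 + Σ< M (λ s → ι (n C suc s) * f (suc s))) + Σ< M (λ s → ι (n C s) * f (suc s))
    ≡⟨ QP.+-assoc (ι 1 * f 0) _ _ ⟩
  ι 1 * f 0 + (Σ< M (λ s → ι (n C suc s) * f (suc s)) + Σ< M (λ s → ι (n C s) * f (suc s)))
    ≡⟨ cong (ι 1 * f 0 +_) (sym (Σ<-+ M (λ s → ι (n C suc s) * f (suc s)) (λ s → ι (n C s) * f (suc s)))) ⟩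
  ι 1 * f 0 + Σ< M (λ s → ι (n C suc s) * f (suc s) + ι (n C s) * f (suc s))
    ≡⟨ cong (ι 1 * f 0 +_) (Σ<-cong M pascal) ⟩
  ι 1 * f 0 + Σ< M (λ s → ι (suc n C suc s) * f (suc s)) ∎
  where
  open ≡-Reasoning
  pascal : ∀ s → ι (n C suc s) * f (suc s) + ι (n C s) * f (suc s) ≡ ι (suc n C suc s) * f (suc s)
  pascal s = begin
    ι (n C suc s) * f (suc s) + ι (n C s) * f (suc s)  ≡⟨ sym (QP.*-distribʳ-+ (f (suc s)) (ι (n C suc s)) (ι (n C s))) ⟩
    (ι (n C suc s) + ι (n C s)) * f (suc s)            ≡⟨ cong (_* f (suc s)) (sym (ι-+ (n C suc s) (n C s))) ⟩
    ι (n C suc s ℕ.+ n C s) * f (suc s)                ≡⟨ cong (λ m → ι m * f (suc s)) (ℕP.+-comm (n C suc s) (n C s)) ⟩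
    ι (n C s ℕ.+ n C suc s) * f (suc s)                ≡⟨ cong (λ m → ι m * f (suc s)) (nCk+nC[k+1]≡[n+1]C[k+1] n s) ⟩
    ι (suc n C suc s) * f (suc s)                      ∎

absorption : ∀ n s → suc s ℕ.* (suc n C suc s) ≡ suc n ℕ.* (n C s)
absorption-step : ∀ m s → s ℕ.* (suc m C s) ℕ.+ suc m ℕ.* (m C s) ≡ suc m ℕ.* (suc m C s)

absorption zero    zero    = refl
absorption zero    (suc s) = ℕP.*-zeroʳ (suc (suc s))
absorption (suc m) s = begin
  suc s ℕ.* (suc (suc m) C suc s)     ≡⟨ cong (suc s ℕ.*_) (sym (nCk+nC[k+1]≡[n+1]C[k+1] (suc m) s)) ⟩
  suc s ℕ.* (X ℕ.+ Y)                 ≡⟨ ℕP.*-distribˡ-+ (suc s) X Y ⟩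
  suc s ℕ.* X ℕ.+ suc s ℕ.* Y         ≡⟨ cong (suc s ℕ.* X ℕ.+_) (absorption m s) ⟩
  (X ℕ.+ s ℕ.* X) ℕ.+ suc m ℕ.* (m C s) ≡⟨ ℕP.+-assoc X (s ℕ.* X) _ ⟩
  X ℕ.+ (s ℕ.* X ℕ.+ suc m ℕ.* (m C s)) ≡⟨ cong (X ℕ.+_) (absorption-step m s) ⟩
  X ℕ.+ suc m ℕ.* X                   ∎
  where
  open ≡-Reasoning
  X = suc m C s
  Y = suc m C suc s

absorption-step m zero    = refl
absorption-step m (suc s) = begin
  suc s ℕ.* (suc m C suc s) ℕ.+ suc m ℕ.* (m C suc s)  ≡⟨ cong (ℕ._+ suc m ℕ.* (m C suc s)) (absorption m s) ⟩
  suc m ℕ.* (m C s) ℕ.+ suc m ℕ.* (m C suc s)          ≡⟨ sym (ℕP.*-distribˡ-+ (suc m) (m C s) (m C suc s)) ⟩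
  suc m ℕ.* (m C s ℕ.+ m C suc s)                      ≡⟨ cong (suc m ℕ.*_) (nCk+nC[k+1]≡[n+1]C[k+1] m s) ⟩
  suc m ℕ.* (suc m C suc s)                            ∎
  where open ≡-Reasoning

Σ-binomial-tail : ∀ n → Σ< (suc n) (λ s → ι (suc n C suc s)) ≡ N (suc n) - 1ℚ
Σ-binomial-tail n = begin
  T                                  ≡⟨ solve 1 (λ x → x := (con 1ℚ :+ x) :- con 1ℚ) refl T ⟩
  (1ℚ + T) - 1ℚ                      ≡⟨ cong (λ z → (1ℚ + z) - 1ℚ) (sym (Σ<-cong (suc n) (λ s → QP.*-identityʳ (ι (suc n C suc s))))) ⟩
  (ι (suc n C 0) * 1ℚ + Σ< (suc n) (λ s → ι (suc n C suc s) * 1ℚ)) - 1ℚ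
    ≡⟨ cong (_- 1ℚ) (sym (ΣV-weight (suc n) (suc (suc n)) (λ _ → 1ℚ) (ℕP.n<1+n (suc n)))) ⟩
  ΣV (suc n) (λ _ → 1ℚ) - 1ℚ         ≡⟨ cong (_- 1ℚ) (trans (ΣV-const (suc n) 1ℚ) (QP.*-identityˡ (N (suc n)))) ⟩
  N (suc n) - 1ℚ                     ∎
  where
  open ≡-Reasoning
  T = Σ< (suc n) (λ s → ι (suc n C suc s))

ΣV-inv-weight : ∀ n → ΣV n (λ S → inv (suc (wt S))) ≡ (N (suc n) - 1ℚ) * inv (suc n)
ΣV-inv-weight n = begin
  ΣV n (λ S → inv (suc (wt S)))                          ≡⟨ ΣV-weight n (suc n) (λ s → inv (suc s)) (ℕP.n<1+n n) ⟩
  Σ< (suc n) (λ s → ι (n C s) * inv (suc s))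
    ≡⟨ Σ<-cong (suc n) (λ s → cross-multiply (suc s) (suc n) (suc n C suc s) (n C s) (absorption n s)) ⟩
  Σ< (suc n) (λ s → ι (suc n C suc s) * inv (suc n))     ≡⟨ Σ<-*ʳ (suc n) (inv (suc n)) (λ s → ι (suc n C suc s)) ⟩
  Σ< (suc n) (λ s → ι (suc n C suc s)) * inv (suc n)     ≡⟨ cong (_* inv (suc n)) (Σ-binomial-tail n) ⟩
  (N (suc n) - 1ℚ) * inv (suc n)                         ∎
  where open ≡-Reasoning

absorption² : ∀ n s → (suc s ℕ.* suc (suc s)) ℕ.* (suc (suc n) C suc (suc s)) ≡ (suc n ℕ.* suc (suc n)) ℕ.* (n C s)
absorption² n s = begin
  (suc s ℕ.* suc (suc s)) ℕ.* (n+2 C suc (suc s))  ≡⟨ ℕP.*-assoc (suc s) (suc (suc s)) (n+2 C suc (suc s)) ⟩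
  suc s ℕ.* (suc (suc s) ℕ.* (n+2 C suc (suc s)))  ≡⟨ cong (suc s ℕ.*_) (absorption (suc n) (suc s)) ⟩
  suc s ℕ.* (n+2 ℕ.* (suc n C suc s))              ≡⟨ exchange (suc s) n+2 (suc n C suc s) ⟩
  n+2 ℕ.* (suc s ℕ.* (suc n C suc s))              ≡⟨ cong (n+2 ℕ.*_) (absorption n s) ⟩
  n+2 ℕ.* (suc n ℕ.* (n C s))                      ≡⟨ sym (ℕP.*-assoc n+2 (suc n) _) ⟩
  (n+2 ℕ.* suc n) ℕ.* (n C s)                      ≡⟨ cong (ℕ._* (n C s)) (ℕP.*-comm n+2 (suc n)) ⟩
  (suc n ℕ.* n+2) ℕ.* (n C s)                      ∎
  where
  open ≡-Reasoning
  n+2 = suc (suc n)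
  exchange : ∀ a b c → a ℕ.* (b ℕ.* c) ≡ b ℕ.* (a ℕ.* c)
  exchange = solve-∀

ΣV-inv-weight² : ∀ n → ΣV n (λ S → inv (suc (wt S) ℕ.* suc (suc (wt S))))
                        ≤q N (suc (suc n)) * inv (suc n ℕ.* suc (suc n))
ΣV-inv-weight² n = begin
  ΣV n (λ S → inv (suc (wt S) ℕ.* suc (suc (wt S))))
    ≡⟨ ΣV-weight n (suc n) (λ s → inv (suc s ℕ.* suc (suc s))) (ℕP.n<1+n n) ⟩
  Σ< (suc n) (λ s → ι (n C s) * inv (suc s ℕ.* suc (suc s)))
    ≡⟨ Σ<-cong (suc n) (λ s → cross-multiply (suc s ℕ.* suc (suc s)) (suc n ℕ.* suc (suc n)) (n+2 C suc (suc s)) (n C s) (absorption² n s)) ⟩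
  Σ< (suc n) (λ s → ι (n+2 C suc (suc s)) * d⁻¹)        ≡⟨ Σ<-*ʳ (suc n) d⁻¹ (λ s → ι (n+2 C suc (suc s))) ⟩
  Σ< (suc n) (λ s → ι (n+2 C suc (suc s))) * d⁻¹
    ≤⟨ QP.*-monoʳ-≤-nonNeg d⁻¹ {{Q.nonNegative (0≤inv (suc n ℕ.* suc (suc n)))}} partial≤total ⟩
  N (suc (suc n)) * d⁻¹                                  ∎
  where
  open QP.≤-Reasoning
  n+2 = suc (suc n)
  d⁻¹ = inv (suc n ℕ.* suc (suc n))
  -- The omitted terms C(n+2,0) and C(n+2,1) are nonnegative.
  partial≤total : Σ< (suc n) (λ s → ι (n+2 C suc (suc s))) ≤q N n+2
  partial≤total = begin
    T                            ≡⟨ sym (Σ<-cong (suc n) (λ s → QP.*-identityʳ (ι (n+2 C suc (suc s))))) ⟩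
    T₁                           ≤⟨ ≤-+-nonneg T₁ (ι (n+2 C 1) * 1ℚ) (QP.≤-trans (0≤ι (n+2 C 1)) (QP.≤-reflexive (sym (QP.*-identityʳ (ι (n+2 C 1)))))) ⟩
    ι (n+2 C 1) * 1ℚ + T₁        ≤⟨ ≤-+-nonneg _ (ι (n+2 C 0) * 1ℚ) (QP.<⇒≤ 0<1) ⟩
    Σ< (suc n+2) (λ s → ι (n+2 C s) * 1ℚ) ≡⟨ sym (ΣV-weight n+2 (suc n+2) (λ _ → 1ℚ) (ℕP.n<1+n n+2)) ⟩
    ΣV n+2 (λ _ → 1ℚ)            ≡⟨ trans (ΣV-const n+2 1ℚ) (QP.*-identityˡ _) ⟩
    N n+2                        ∎
    where
    T  = Σ< (suc n) (λ s → ι (n+2 C suc (suc s)))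
    T₁ = Σ< (suc n) (λ s → ι (n+2 C suc (suc s)) * 1ℚ)

-- Two-sided estimates for the trace W n k = Σ_S 1/(2|S| + c_S), c_S ∈ {0,2},
-- by functions of |S| whose sums over the cube are known in closed form.

half : ℚ
half = inv 2

inv-double : ∀ m → inv (m ℕ.+ m) ≡ half * inv m
inv-double m = trans (cong inv (cong (m ℕ.+_) (sym (ℕP.+-identityʳ m)))) (inv-* 2 m)

isZero : ℕ → ℚ
isZero zero    = 1ℚ
isZero (suc _) = 0ℚ

-- Pointwise bounds lowerTerm |S| ≤ 1/ev(S) ≤ upperTerm |S|; the correction
-- -[|S| = 0]/2 in lowerTerm accounts for the zero eigenvalue of S = 0.
lowerTerm : ℕ → ℚ
lowerTerm w = half * inv (suc w) - half * isZero w

upperTerm : ℕ → ℚ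
upperTerm w = half * (inv (suc w) + ι 3 * inv (suc w ℕ.* suc (suc w)))

-- 1/(t+1) ≤ 1/(t+2) + 3/((t+2)(t+3)), i.e. (t+2)(t+3) ≤ (t+6)(t+1).
harmonic-step : ∀ t → inv (suc t) ≤q inv (suc (suc t)) + ι 3 * inv (suc (suc t) ℕ.* suc (suc (suc t)))
harmonic-step t = begin
  inv (suc t)                        ≡⟨ sym (QP.*-identityˡ (inv (suc t))) ⟩
  ι 1 * inv (suc t)                  ≤⟨ ratio-≤ 1 (3 ℕ.+ suc (suc (suc t))) (suc t) bc cross ⟩
  ι (3 ℕ.+ suc (suc (suc t))) * inv bc ≡⟨ cong (_* inv bc) (trans (ι-+ 3 (suc (suc (suc t)))) (QP.+-comm (ι 3) (ι (suc (suc (suc t)))))) ⟩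
  (ι (suc (suc (suc t))) + ι 3) * inv bc ≡⟨ QP.*-distribʳ-+ (inv bc) (ι (suc (suc (suc t)))) (ι 3) ⟩
  ι (suc (suc (suc t))) * inv bc + ι 3 * inv bc
    ≡⟨ cong (_+ ι 3 * inv bc) (sym (trans (sym (QP.*-identityˡ (inv (suc (suc t)))))
         (cross-multiply (suc (suc t)) bc (suc (suc (suc t))) 1 (sym (ℕP.*-identityʳ bc))))) ⟩
  inv (suc (suc t)) + ι 3 * inv bc   ∎
  where
  open QP.≤-Reasoning
  bc = suc (suc t) ℕ.* suc (suc (suc t))
  cross : 1 ℕ.* bc ℕ.≤ (3 ℕ.+ suc (suc (suc t))) ℕ.* suc t
  cross = ℕP.≤-trans (ℕP.m≤m+n (1 ℕ.* bc) (2 ℕ.* t)) (ℕP.≤-reflexive (expand t))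
    where
    expand : ∀ t → 1 ℕ.* ((2 ℕ.+ t) ℕ.* (3 ℕ.+ t)) ℕ.+ 2 ℕ.* t ≡ (6 ℕ.+ t) ℕ.* (1 ℕ.+ t)
    expand = solve-∀

-- The eigenvalue of Q_{n,k} on χ_S has the form 2|S| + c with c ∈ {0,2}.
ZeroOrTwo : ℕ → Set
ZeroOrTwo c = c ≡ 0 ⊎ c ≡ 2

lowerTerm-≤ : ∀ w c → ZeroOrTwo c → lowerTerm w ≤q inv ((w ℕ.+ w) ℕ.+ c)
lowerTerm-≤ zero    .0 (inj₁ refl) = toWitness {a? = lowerTerm 0 QP.≤? inv 0} _
lowerTerm-≤ zero    .2 (inj₂ refl) = toWitness {a? = lowerTerm 0 QP.≤? inv 2} _
lowerTerm-≤ (suc t) c  c∈02        = begin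
  half * inv (suc (suc t)) - half * 0ℚ  ≡⟨ solve 2 (λ H I → H :* I :- H :* con 0ℚ := H :* I) refl half (inv (suc (suc t))) ⟩
  half * inv (suc (suc t))              ≡⟨ sym (inv-double (suc (suc t))) ⟩
  inv (suc (suc t) ℕ.+ suc (suc t))     ≤⟨ inv-anti ((t ℕ.+ suc t) ℕ.+ c) _ (c≤2 c∈02) ⟩
  inv ((suc t ℕ.+ suc t) ℕ.+ c)         ∎
  where
  open QP.≤-Reasoning
  c≤2 : ZeroOrTwo c → suc ((t ℕ.+ suc t) ℕ.+ c) ℕ.≤ suc (suc t) ℕ.+ suc (suc t)
  c≤2 (inj₁ refl) = ℕP.≤-trans (ℕP.m≤m+n _ 2) (ℕP.≤-reflexive (c=0 t))
    where
    c=0 : ∀ t → suc ((t ℕ.+ suc t) ℕ.+ 0) ℕ.+ 2 ≡ suc (suc t) ℕ.+ suc (suc t)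
    c=0 = solve-∀
  c≤2 (inj₂ refl) = ℕP.≤-reflexive (c=2 t)
    where
    c=2 : ∀ t → suc ((t ℕ.+ suc t) ℕ.+ 2) ≡ suc (suc t) ℕ.+ suc (suc t)
    c=2 = solve-∀

upperTerm-≥ : ∀ w c → ZeroOrTwo c → inv ((w ℕ.+ w) ℕ.+ c) ≤q upperTerm w
upperTerm-≥ zero    .0 (inj₁ refl) = toWitness {a? = inv 0 QP.≤? upperTerm 0} _
upperTerm-≥ zero    .2 (inj₂ refl) = toWitness {a? = inv 2 QP.≤? upperTerm 0} _
upperTerm-≥ (suc t) c  _           = begin
  inv ((suc t ℕ.+ suc t) ℕ.+ c)  ≤⟨ inv-anti (t ℕ.+ suc t) _ (ℕP.m≤m+n (suc t ℕ.+ suc t) c) ⟩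
  inv (suc t ℕ.+ suc t)          ≡⟨ inv-double (suc t) ⟩
  half * inv (suc t)             ≤⟨ QP.*-monoˡ-≤-nonNeg half (harmonic-step t) ⟩
  upperTerm (suc t)              ∎
  where open QP.≤-Reasoning

tailTerm-ZeroOrTwo : ∀ b → ZeroOrTwo (if b then 2 else 0)
tailTerm-ZeroOrTwo false = inj₁ refl
tailTerm-ZeroOrTwo true  = inj₂ refl

ΣV-isZero : ∀ n → ΣV n (λ S → isZero (wt S)) ≡ 1ℚ
ΣV-isZero n = begin
  ΣV n (λ S → isZero (wt S))                        ≡⟨ ΣV-weight n (suc n) isZero (ℕP.n<1+n n) ⟩
  ι (n C 0) * 1ℚ + Σ< n (λ s → ι (n C suc s) * 0ℚ)  ≡⟨ cong (ι 1 * 1ℚ +_) (trans (Σ<-cong n (λ s → QP.*-zeroʳ (ι (n C suc s)))) (Σ<-0 n)) ⟩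
  1ℚ                                                ∎
  where open ≡-Reasoning

ΣV-lowerTerm : ∀ n → ΣV n (λ S → lowerTerm (wt S)) ≡ half * ((N (suc n) - 1ℚ) * inv (suc n)) - half * 1ℚ
ΣV-lowerTerm n =
  trans (sum-- (allStrings n) (λ S → half * inv (suc (wt S))) (λ S → half * isZero (wt S)))
        (cong₂ _-_ (trans (sum-*ˡ (allStrings n) half (λ S → inv (suc (wt S)))) (cong (half *_) (ΣV-inv-weight n)))
                   (trans (sum-*ˡ (allStrings n) half (λ S → isZero (wt S))) (cong (half *_) (ΣV-isZero n))))

ΣV-upperTerm : ∀ n → ΣV n (λ S → upperTerm (wt S))
                      ≤q half * ((N (suc n) - 1ℚ) * inv (suc n) + ι 3 * (N (suc (suc n)) * inv (suc n ℕ.* suc (suc n))))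
ΣV-upperTerm n = begin
  ΣV n (λ S → upperTerm (wt S))
    ≡⟨ sum-*ˡ (allStrings n) half (λ S → inv (suc (wt S)) + ι 3 * inv (suc (wt S) ℕ.* suc (suc (wt S)))) ⟩
  half * ΣV n (λ S → inv (suc (wt S)) + ι 3 * inv (suc (wt S) ℕ.* suc (suc (wt S))))
    ≡⟨ cong (half *_) (trans (sum-+ (allStrings n) (λ S → inv (suc (wt S))) (λ S → ι 3 * inv (suc (wt S) ℕ.* suc (suc (wt S)))))
                             (cong₂ _+_ (ΣV-inv-weight n) (sum-*ˡ (allStrings n) (ι 3) (λ S → inv (suc (wt S) ℕ.* suc (suc (wt S))))))) ⟩
  half * ((N (suc n) - 1ℚ) * inv (suc n) + ι 3 * ΣV n (λ S → inv (suc (wt S) ℕ.* suc (suc (wt S)))))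
    ≤⟨ QP.*-monoˡ-≤-nonNeg half (QP.+-monoʳ-≤ ((N (suc n) - 1ℚ) * inv (suc n))
                                  (QP.*-monoˡ-≤-nonNeg (ι 3) (ΣV-inv-weight² n))) ⟩
  half * ((N (suc n) - 1ℚ) * inv (suc n) + ι 3 * (N (suc (suc n)) * inv (suc n ℕ.* suc (suc n)))) ∎
  where open QP.≤-Reasoning

scale : ℕ → ℚ
scale n = ι (suc n) * inv (2 ℕ.^ n)

0≤scale : ∀ n → 0ℚ ≤q scale n
0≤scale n = QP.≤-trans (QP.≤-reflexive (sym (QP.*-zeroˡ (inv (2 ℕ.^ n)))))
                       (QP.*-monoʳ-≤-nonNeg (inv (2 ℕ.^ n)) {{Q.nonNegative (0≤inv (2 ℕ.^ n))}} (0≤ι (suc n)))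

err : ℕ → ℚ
err n = ι 6 * inv (suc (suc n))

square≤exp : ∀ n → suc (suc n) ℕ.* suc (suc n) ℕ.≤ 6 ℕ.* 2 ℕ.^ suc n
square≤exp zero          = ℕP.m≤m+n 4 8
square≤exp (suc zero)    = ℕP.m≤m+n 9 15
square≤exp (suc (suc m)) = begin
  (4 ℕ.+ m) ℕ.* (4 ℕ.+ m)                    ≤⟨ ℕP.m≤m+n _ (m ℕ.* m ℕ.+ 4 ℕ.* m ℕ.+ 2) ⟩
  (4 ℕ.+ m) ℕ.* (4 ℕ.+ m) ℕ.+ (m ℕ.* m ℕ.+ 4 ℕ.* m ℕ.+ 2) ≡⟨ doubling m ⟩
  2 ℕ.* ((3 ℕ.+ m) ℕ.* (3 ℕ.+ m))            ≤⟨ ℕP.*-monoʳ-≤ 2 (square≤exp (suc m)) ⟩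
  2 ℕ.* (6 ℕ.* 2 ℕ.^ suc (suc m))            ≡⟨ exchange 2 6 (2 ℕ.^ suc (suc m)) ⟩
  6 ℕ.* 2 ℕ.^ suc (suc (suc m))              ∎
  where
  open ℕP.≤-Reasoning
  doubling : ∀ m → (4 ℕ.+ m) ℕ.* (4 ℕ.+ m) ℕ.+ (m ℕ.* m ℕ.+ 4 ℕ.* m ℕ.+ 2) ≡ 2 ℕ.* ((3 ℕ.+ m) ℕ.* (3 ℕ.+ m))
  doubling = solve-∀
  exchange : ∀ a b c → a ℕ.* (b ℕ.* c) ≡ b ℕ.* (a ℕ.* c)
  exchange = solve-∀

exp-correction≤err : ∀ n → half * ι (suc (suc n)) * inv (2 ℕ.^ n) ≤q err n
exp-correction≤err n = begin
  half * ι (suc (suc n)) * inv (2 ℕ.^ n)  ≡⟨ solve 3 (λ H A I → H :* A :* I := A :* (H :* I)) refl half (ι (suc (suc n))) (inv (2 ℕ.^ n)) ⟩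
  ι (suc (suc n)) * (half * inv (2 ℕ.^ n)) ≡⟨ cong (ι (suc (suc n)) *_) (sym (inv-* 2 (2 ℕ.^ n))) ⟩
  ι (suc (suc n)) * inv (2 ℕ.^ suc n)      ≤⟨ ratio-≤ (suc (suc n)) 6 (2 ℕ.^ suc n) (suc (suc n)) {{ℕP.m^n≢0 2 (suc n)}} (square≤exp n) ⟩
  err n                                    ∎
  where open QP.≤-Reasoning

lower-identity : ∀ n → scale n * (half * ((N (suc n) - 1ℚ) * inv (suc n)) - half * 1ℚ)
                       ≡ 1ℚ - half * ι (suc (suc n)) * inv (2 ℕ.^ n)
lower-identity n = begin
  a₁ * i₂ * (half * ((N (suc n) - 1ℚ) * i₁) - half * 1ℚ)
    ≡⟨ cong (λ z → a₁ * i₂ * (half * ((z - 1ℚ) * i₁) - half * 1ℚ)) (N-suc n) ⟩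
  a₁ * i₂ * (half * ((N n + N n - 1ℚ) * i₁) - half * 1ℚ)
    ≡⟨ solve 5 (λ A I M J H → A :* I :* (H :* ((M :+ M :- con 1ℚ) :* J) :- H :* con 1ℚ)
                            := (H :+ H) :* (M :* I) :* (A :* J) :- H :* I :* (A :* J) :- H :* A :* I)
               refl a₁ i₂ (N n) i₁ half ⟩
  (half + half) * (N n * i₂) * (a₁ * i₁) - half * i₂ * (a₁ * i₁) - half * a₁ * i₂
    ≡⟨ cong₂ (λ u v → (half + half) * u * v - half * i₂ * v - half * a₁ * i₂) (N*inv n) (ι*inv (suc n)) ⟩
  1ℚ * 1ℚ * 1ℚ - half * i₂ * 1ℚ - half * a₁ * i₂
    ≡⟨ solve 3 (λ H I A → con 1ℚ :* con 1ℚ :* con 1ℚ :- H :* I :* con 1ℚ :- H :* A :* I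
                        := con 1ℚ :- H :* (con 1ℚ :+ A) :* I) refl half i₂ a₁ ⟩
  1ℚ - half * ι (suc (suc n)) * i₂ ∎
  where
  open ≡-Reasoning
  a₁ = ι (suc n)
  i₁ = inv (suc n)
  i₂ = inv (2 ℕ.^ n)

upper-identity : ∀ n → scale n * (half * ((N (suc n) - 1ℚ) * inv (suc n) + ι 3 * (N (suc (suc n)) * inv (suc n ℕ.* suc (suc n)))))
                       ≡ 1ℚ - half * inv (2 ℕ.^ n) + err n
upper-identity n = begin
  a₁ * i₂ * (half * ((N (suc n) - 1ℚ) * i₁ + ι 3 * (N (suc (suc n)) * inv (suc n ℕ.* suc (suc n)))))
    ≡⟨ cong₂ (λ u v → a₁ * i₂ * (half * ((u - 1ℚ) * i₁ + ι 3 * v)))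
             (N-suc n) (cong₂ _*_ (trans (N-suc (suc n)) (cong (λ z → z + z) (N-suc n))) (inv-* (suc n) (suc (suc n)))) ⟩
  a₁ * i₂ * (half * ((N n + N n - 1ℚ) * i₁ + ι 3 * (((N n + N n) + (N n + N n)) * (i₁ * i₃))))
    ≡⟨ solve 6 (λ A I M J K H → A :* I :* (H :* ((M :+ M :- con 1ℚ) :* J :+ con (ι 3) :* (((M :+ M) :+ (M :+ M)) :* (J :* K))))
                              := (H :+ H) :* (M :* I) :* (A :* J) :- H :* I :* (A :* J)
                                 :+ (H :* con (ι 3) :* con (ι 4)) :* (M :* I) :* (A :* J) :* K)
               refl a₁ i₂ (N n) i₁ i₃ half ⟩
  (half + half) * (N n * i₂) * (a₁ * i₁) - half * i₂ * (a₁ * i₁) + (half * ι 3 * ι 4) * (N n * i₂) * (a₁ * i₁) * i₃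
    ≡⟨ cong₂ (λ u v → (half + half) * u * v - half * i₂ * v + (half * ι 3 * ι 4) * u * v * i₃) (N*inv n) (ι*inv (suc n)) ⟩
  1ℚ * 1ℚ * 1ℚ - half * i₂ * 1ℚ + ι 6 * 1ℚ * 1ℚ * i₃
    ≡⟨ solve 3 (λ H I K → con 1ℚ :* con 1ℚ :* con 1ℚ :- H :* I :* con 1ℚ :+ con (ι 6) :* con 1ℚ :* con 1ℚ :* K
                        := con 1ℚ :- H :* I :+ con (ι 6) :* K) refl half i₂ i₃ ⟩
  1ℚ - half * i₂ + err n ∎
  where
  open ≡-Reasoning
  a₁ = ι (suc n)
  i₁ = inv (suc n)
  i₂ = inv (2 ℕ.^ n)
  i₃ = inv (suc (suc n))

lower-bound : ∀ n k → 1ℚ - err n ≤q scale n * W n k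
lower-bound n k = begin
  1ℚ - err n    ≤⟨ QP.+-monoʳ-≤ 1ℚ (QP.neg-antimono-≤ (exp-correction≤err n)) ⟩
  1ℚ - half * ι (suc (suc n)) * inv (2 ℕ.^ n)
    ≡⟨ sym (trans (cong (scale n *_) (ΣV-lowerTerm n)) (lower-identity n)) ⟩
  scale n * ΣV n (λ S → lowerTerm (wt S))
    ≤⟨ QP.*-monoˡ-≤-nonNeg (scale n) {{Q.nonNegative (0≤scale n)}}
         (sum-mono (allStrings n) (λ S → lowerTerm-≤ (wt S) _ (tailTerm-ZeroOrTwo ⟨ S , tailMask (k ∸ 1) n ⟩))) ⟩
  scale n * W n k ∎
  where open QP.≤-Reasoning

upper-bound : ∀ n k → scale n * W n k ≤q 1ℚ + err n
upper-bound n k = begin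
  scale n * W n k
    ≤⟨ QP.*-monoˡ-≤-nonNeg (scale n) {{Q.nonNegative (0≤scale n)}}
         (QP.≤-trans (sum-mono (allStrings n) (λ S → upperTerm-≥ (wt S) _ (tailTerm-ZeroOrTwo ⟨ S , tailMask (k ∸ 1) n ⟩)))
                     (ΣV-upperTerm n)) ⟩
  scale n * (half * ((N (suc n) - 1ℚ) * inv (suc n) + ι 3 * (N (suc (suc n)) * inv (suc n ℕ.* suc (suc n)))))
    ≡⟨ upper-identity n ⟩
  1ℚ - half * inv (2 ℕ.^ n) + err n
    ≤⟨ QP.+-monoˡ-≤ (err n) (QP.+-monoʳ-≤ 1ℚ (QP.neg-antimono-≤ 0≤correction)) ⟩
  1ℚ - 0ℚ + err n ∎
  where
  open QP.≤-Reasoning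
  0≤correction : 0ℚ ≤q half * inv (2 ℕ.^ n)
  0≤correction = QP.*-monoˡ-≤-nonNeg half (0≤inv (2 ℕ.^ n))

close-to-1 : ∀ q e ε → 1ℚ - e ≤q q → q ≤q 1ℚ + e → e <q ε → ∣ q - 1ℚ ∣ <q ε
close-to-1 q e ε lower upper e<ε with QP.∣p∣≡p∨∣p∣≡-p (q - 1ℚ)
... | inj₁ ∣q-1∣≡q-1 rewrite ∣q-1∣≡q-1 = QP.≤-<-trans above e<ε
  where
  open QP.≤-Reasoning
  above : q - 1ℚ ≤q e
  above = begin
    q - 1ℚ       ≤⟨ QP.+-monoˡ-≤ (- 1ℚ) upper ⟩
    1ℚ + e - 1ℚ  ≡⟨ solve 1 (λ E → con 1ℚ :+ E :- con 1ℚ := E) refl e ⟩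
    e            ∎
... | inj₂ ∣q-1∣≡1-q rewrite ∣q-1∣≡1-q = QP.≤-<-trans below e<ε
  where
  open QP.≤-Reasoning
  below : - (q - 1ℚ) ≤q e
  below = begin
    - (q - 1ℚ)          ≡⟨ solve 1 (λ Q' → :- (Q' :- con 1ℚ) := con 1ℚ :+ (:- Q')) refl q ⟩
    1ℚ + (- q)          ≤⟨ QP.+-monoʳ-≤ 1ℚ (QP.neg-antimono-≤ lower) ⟩
    1ℚ + (- (1ℚ - e))   ≡⟨ solve 1 (λ E → con 1ℚ :+ (:- (con 1ℚ :- E)) := E) refl e ⟩
    e                   ∎

archimedean : ∀ ε → 0ℚ <q ε → ∃[ d ] (inv (suc d) ≤q ε)
archimedean (Q.mkℚ (ℤ.+ 0)       d _) (Q.*<* (ℤ.+<+ ()))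
archimedean (Q.mkℚ ℤ.-[1+ p ]    d _) (Q.*<* ())
archimedean ε@(Q.mkℚ (ℤ.+ suc p) d _) _ = d , (begin
  inv (suc d)             ≡⟨ sym (QP.*-identityˡ (inv (suc d))) ⟩
  ι 1 * inv (suc d)       ≤⟨ ratio-≤ 1 (suc p) (suc d) (suc d) (ℕP.*-monoˡ-≤ (suc d) (ℕ.s≤s (ℕ.z≤n {p}))) ⟩
  ι (suc p) * inv (suc d) ≡⟨ sym (fraction (suc p) (suc d)) ⟩
  Q.fromℚᵘ (Q.toℚᵘ ε)     ≡⟨ QP.fromℚᵘ-toℚᵘ ε ⟩
  ε                       ∎)
  where open QP.≤-Reasoning

err-small : ∀ d n → 6 ℕ.* suc d ℕ.≤ n → err n <q inv (suc d)
err-small d n 6d≤n = QP.<-≤-trans (ratio-< 6 1 (suc (suc n)) (suc d) 6d<n+2)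
                                  (QP.≤-reflexive (QP.*-identityˡ (inv (suc d))))
  where
  6d<n+2 : 6 ℕ.* suc d ℕ.< 1 ℕ.* suc (suc n)
  6d<n+2 = ℕP.≤-trans (ℕ.s≤s (ℕP.≤-trans 6d≤n (ℕP.n≤1+n n))) (ℕP.≤-reflexive (sym (ℕP.*-identityˡ (suc (suc n)))))

-- 1 ≤ k ≤ n-1 means the complemented tail x_k … x_n has length ≥ 2.
tail≥2 : ∀ n k → 1 ℕ.≤ k → k ℕ.≤ n ∸ 1 → 2 ℕ.≤ n ∸ (k ∸ 1)
tail≥2 (suc n) (suc k) _ k<n = m+2≤n⇒2≤n∸m (suc n) k (ℕ.s≤s k<n)
  where
  m+2≤n⇒2≤n∸m : ∀ n m → suc (suc m) ℕ.≤ n → 2 ℕ.≤ n ∸ m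
  m+2≤n⇒2≤n∸m n       zero    le         = le
  m+2≤n⇒2≤n∸m (suc n) (suc m) (ℕ.s≤s le) = m+2≤n⇒2≤n∸m n m le

-- Main theorem: Kf(Q_{n,k_n}) · (n+1)/2²ⁿ → 1.  Given ε, choose d with
-- 1/(d+1) ≤ ε; for n ≥ 6(d+1) the normalised index equals (n+1)/2ⁿ · W and
-- lies within 6/(n+2) < 1/(d+1) of 1.
theorem7 : (k : ℕ → ℕ) → (∀ n → 2 ≤ n → 1 ≤ k n × k n ≤ n ∸ 1)
         → (R : (n : ℕ) → Vec Bool n → Vec Bool n → ℚ)
         → (∀ n → 2 ≤ n → IsResistanceDistance n (k n) (R n))
         → ConvergesTo (λ n → normalizedKf n (R n)) 1ℚ
theorem7 k k-range R R-resistance ε ε>0 with archimedean ε ε>0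
... | d , 1/d≤ε = 6 ℕ.* suc d , estimate
  where
  estimate : ∀ n → 6 ℕ.* suc d ≤ n → ∣ normalizedKf n (R n) - 1ℚ ∣ <q ε
  estimate n M≤n = subst (λ q → ∣ q - 1ℚ ∣ <q ε) (sym spectral)
    (close-to-1 _ (err n) ε (lower-bound n (k n)) (upper-bound n (k n))
      (QP.<-≤-trans (err-small d n M≤n) 1/d≤ε))
    where
    n≥2 : 2 ≤ n
    n≥2 = ℕP.≤-trans (ℕ.s≤s (ℕ.s≤s ℕ.z≤n)) (ℕP.≤-trans (ℕP.m≤m*n 6 (suc d)) M≤n)
    spectral : normalizedKf n (R n) ≡ scale n * W n (k n)
    spectral = normalizedKf-spectral n (k n)
      (tail≥2 n (k n) (proj₁ (k-range n n≥2)) (proj₂ (k-range n n≥2))) (R n) (R-resistance n n≥2)
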